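{- Let $Q^+(7,2)$ be a non-degenerate hyperbolic quadric of ${\rm PG}(7,2)$ with fixed generator $\Pi$, and let $\mathcal G_3$ be the graph with vertex set $Q^+(7,2)\setminus\Pi$ where distinct vertices $P_1,P_2$ are adjacent iff $P_1\sim_1P_2$ (the line $\langle P_1,P_2\rangle$ is secant to $Q^+(7,2)$) or $P_1\sim_2 P_2$ (the line $\langle P_1,P_2\rangle$ is contained in $Q^+(7,2)$ and meets $\Pi$ in a point). Let $\mathcal C=\{P,Q,R\}$ be a clique of mixed type in $\mathcal G_3$, and let $T$ be a vertex not in the plane $\langle P,Q,R\rangle$ such that $\{P,Q,R,T\}$ is a clique and $T$ is in relation $\sim_2$ with at least one vertex of $\mathcal C$. Then $\gamma=\langle P,Q,R,T\rangle$ is a solid and $\gamma\cap Q^+(7,2)=lQ^+(1,2)$ for a line $l$ contained in $\Pi$; moreover there is exactly one maximal clique of $\mathcal G_3$ containing $\{P,Q,R,T\}$, it has size $8$, and it is the set of vertices of $\mathcal G_3$ lying in $lQ^+(1,2)$.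
   Context: A generator of $Q^+(7,2)$ is a solid contained in the quadric. A clique is of mixed type if it contains both a pair in relation $\sim_1$ and a pair in relation $\sim_2$. $lQ^+(1,2)$ denotes a quadratic cone in a solid with vertex the line $l$ and base a hyperbolic quadric $Q^+(1,2)$ (a pair of points), i.e. the union of two distinct planes through $l$. -}

module Defs where

open import Data.Bool using (Bool; true; false; _xor_; _∧_; if_then_else_; not)
open import Data.Nat using (ℕ; _≤ᵇ_)
open import Data.Fin using (Fin; toℕ)
open import Data.Vec using (Vec; []; _∷_; replicate; zipWith; lookup; map)
open import Data.List as L using (List; []; _∷_; length; allFin; concatMap; foldr)
open import Data.List.Membership.Propositional using (_∈_; _∉_)
open import Data.List.Relation.Unary.All using (All)
open import Data.List.Relation.Unary.Any using (Any)
open import Data.List.Relation.Unary.Unique.Propositional using (Unique)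
open import Data.Product using (Σ; _×_; ∃; ∃-syntax)
open import Data.Sum using (_⊎_)
open import Relation.Binary.PropositionalEquality using (_≡_; _≢_)
open import Relation.Nullary using (¬_)
open import Function.Bundles using (_⇔_)

V : Set
V = Vec Bool 8

𝟘 : V
𝟘 = replicate 8 false

_⊕_ : V → V → V
_⊕_ = zipWith _xor_

_·_ : Bool → V → V
b · v = map (b ∧_) v

-- A point of PG(7,2) is a nonzero vector (over GF(2) each projective
-- point has exactly one nonzero representative).
IsPoint : V → Set
IsPoint x = x ≢ 𝟘

lc : (vs : List V) → Vec Bool (length vs) → V
lc []       []       = 𝟘
lc (v ∷ vs) (c ∷ cs) = (c · v) ⊕ lc vs cs

InSpan : List V → V → Set
InSpan vs x = Σ (Vec Bool (length vs)) λ cs → lc vs cs ≡ x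

LinIndep : List V → Set
LinIndep vs = (cs : Vec Bool (length vs)) → lc vs cs ≡ 𝟘 → cs ≡ replicate (length vs) false

-- Quadratic forms on GF(2)^8:  q(x) = Σ_{i ≤ j} c i j x_i x_j

Coeffs : Set
Coeffs = Fin 8 → Fin 8 → Bool

xorsum : List Bool → Bool
xorsum = foldr _xor_ false

evalQ : Coeffs → V → Bool
evalQ c x = xorsum (concatMap (λ i → L.map (λ j →
  if toℕ i ≤ᵇ toℕ j then c i j ∧ (lookup x i ∧ lookup x j) else false)
  (allFin 8)) (allFin 8))

polar : Coeffs → V → V → Bool
polar c x y = evalQ c (x ⊕ y) xor (evalQ c x xor evalQ c y)

-- the quadric {q = 0} is non-degenerate (in PG(7,2), i.e. odd projective
-- dimension over characteristic 2: the polar form has trivial radical)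
NonDegenerate : Coeffs → Set
NonDegenerate c = (x : V) → ((y : V) → polar c x y ≡ false) → x ≡ 𝟘

module Geometry (c : Coeffs) (Π : List V) where

  OnQuadric : V → Set
  OnQuadric x = IsPoint x × evalQ c x ≡ false

  InΠ : V → Set
  InΠ = InSpan Π

  IsVertex : V → Set
  IsVertex x = OnQuadric x × ¬ InΠ x

  linePoints : V → V → List V
  linePoints x y = x ∷ y ∷ (x ⊕ y) ∷ []

  Secant : V → V → Set
  Secant x y = Σ V λ a → Σ V λ b → a ∈ linePoints x y × b ∈ linePoints x y ×
    a ≢ b × OnQuadric a × OnQuadric b ×
    ((z : V) → z ∈ linePoints x y → OnQuadric z → z ≡ a ⊎ z ≡ b)

  LineInQuadric : V → V → Set
  LineInQuadric x y = All OnQuadric (linePoints x y)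

  MeetsΠInPoint : V → V → Set
  MeetsΠInPoint x y = Σ V λ a → a ∈ linePoints x y × InΠ a ×
    ((z : V) → z ∈ linePoints x y → InΠ z → z ≡ a)

  _∼₁_ : V → V → Set
  x ∼₁ y = Secant x y

  _∼₂_ : V → V → Set
  x ∼₂ y = LineInQuadric x y × MeetsΠInPoint x y

  Adj : V → V → Set
  Adj x y = IsVertex x × IsVertex y × x ≢ y × (x ∼₁ y ⊎ x ∼₂ y)

  IsClique : List V → Set
  IsClique K = Unique K × All IsVertex K ×
    ((x y : V) → x ∈ K → y ∈ K → x ≢ y → Adj x y)

  IsMaximalClique : List V → Set
  IsMaximalClique K = IsClique K ×
    ((v : V) → IsVertex v → v ∉ K → ¬ ((w : V) → w ∈ K → Adj v w))

  MixedType : V → V → V → Set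
  MixedType P Q R =
    Any (λ xy → Data.Product.proj₁ xy ∼₁ Data.Product.proj₂ xy) pairs ×
    Any (λ xy → Data.Product.proj₁ xy ∼₂ Data.Product.proj₂ xy) pairs
    where
    open import Data.Product using (_,_)
    pairs : List (V × V)
    pairs = (P , Q) ∷ (P , R) ∷ (Q , R) ∷ []

  -- the set γ ∩ Q⁺(7,2) is a cone lQ⁺(1,2): the union of two distinct
  -- planes ⟨a,b,e₁⟩, ⟨a,b,e₂⟩ of γ through the line l = ⟨a,b⟩
  IsConeOverPointPair : List V → V → V → Set
  IsConeOverPointPair γ a b = Σ V λ e₁ → Σ V λ e₂ →
    LinIndep (a ∷ b ∷ e₁ ∷ e₂ ∷ []) ×
    All (InSpan γ) (a ∷ b ∷ e₁ ∷ e₂ ∷ []) ×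
    ((x : V) → (OnQuadric x × InSpan γ x) ⇔
                (IsPoint x × (InSpan (a ∷ b ∷ e₁ ∷ []) x ⊎ InSpan (a ∷ b ∷ e₂ ∷ []) x)))

{-# OPTIONS --safe #-}
module Submission where

-- Write x ≈ y when x ⊕ y ∈ Π. Two adjacent vertices are ∼₂ exactly when x ≈ y, and then the
-- polar form B vanishes on them; otherwise they are ∼₁ and B x y = 1. The hypotheses force
-- P, Q, R, T into exactly two ≈-classes, represented by x₀ and x₁. Differences of members of a
-- class lie in Π and in the radical of the solid γ = ⟨P, Q, R, T⟩; two of them, a and b, span
-- the line l = γ ∩ Π, and γ is the union of the cosets l, x₀ + l, x₁ + l and x₀ + x₁ + l, on
-- which q takes the values 0, 0, 0 and 1. So γ meets the quadric in the planes ⟨l, x₀⟩ and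
-- ⟨l, x₁⟩, and the eight points of (x₀ + l) ∪ (x₁ + l) are the vertices of γ; they form a clique.
--
-- This clique is the unique maximal one through P, Q, R, T because every vertex v adjacent to
-- all four lies in γ. Here non-degeneracy enters: two mutually orthogonal independent families
-- have at most 8 members together. Hence v is ≈ to some p among the four (otherwise v would be
-- orthogonal to l, so in ⟨x₀, x₁⟩ + Π, all of whose points outside the two classes are off the
-- quadric), and then v ⊕ p lies in Π ∩ ⟨p, p′⟩^⊥ = l for a p′ of the other class.

open import Defs

open import Algebra.Bundles using (CommutativeRing; CommutativeSemigroup)
import Algebra.Properties.CommutativeSemigroup as CommutativeSemigroupProperties
open import Data.Bool using (Bool; true; false; _xor_; _∧_; if_then_else_)
open import Data.Bool.Properties
  using ( ¬-not; xor-comm; xor-assoc; xor-identityˡ; xor-identityʳ; xor-same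
        ; ∧-distribˡ-xor; ∧-distribʳ-xor; ∧-zeroʳ; ∧-identityʳ; xor-∧-commutativeRing )
  renaming (_≟_ to _≟ᵇ_)
open import Data.Empty using (⊥; ⊥-elim)
open import Data.Fin using (Fin; combine; remQuot; toℕ)
import Data.Fin.Properties as Fin
open import Data.List using (List; []; _∷_; length; _∷ʳ_; _++_; [_]; concatMap; allFin)
import Data.List as List
open import Data.List.Properties using (++-assoc; length-++)
import Data.List.Properties as List
open import Data.List.Membership.Propositional using (_∈_; _∉_; find; lose)
open import Data.List.Membership.Propositional.Properties using (∈-++⁺ˡ; ∈-++⁺ʳ; ∈-++⁻; ∈-map⁺; ∈-map⁻)
open import Data.List.Relation.Binary.Disjoint.Propositional using (Disjoint)
open import Data.List.Relation.Binary.Permutation.Propositional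
  using (_↭_; ↭-refl; ↭-sym; ↭⇒↭ₛ; prep; swap)
open import Data.List.Relation.Binary.Permutation.Propositional.Properties
  using (∈-resp-↭; All-resp-↭; shift; ++⁺ʳ)
import Data.List.Relation.Binary.Permutation.Setoid.Properties as PermutationSetoid
open import Data.List.Relation.Unary.All using (All; []; _∷_)
import Data.List.Relation.Unary.All as All
import Data.List.Relation.Unary.AllPairs as AllPairs
open import Data.List.Relation.Unary.Any using (Any; here; there)
import Data.List.Relation.Unary.Any as Any
open import Data.List.Relation.Unary.Unique.Propositional using (Unique)
import Data.List.Relation.Unary.Unique.Propositional.Properties as Unique
open import Data.Nat using (ℕ; zero; suc; _+_; _^_; _<_; _≤_; _≤?_; _≤ᵇ_; s≤s; z≤n)
open import Data.Nat.Properties using (^-monoʳ-<; ≰⇒>; ≤-trans; +-monoˡ-≤; 1+n≰n)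
open import Data.Product using (Σ; _×_; _,_; proj₁; proj₂; uncurry)
open import Data.Sum using (_⊎_; inj₁; inj₂; [_,_]′)
import Data.Sum as Sum
open import Data.Vec using (Vec; []; _∷_; replicate; zipWith; map; fromList; toList; lookup)
import Data.Vec.Properties as Vec
open import Function using (_∘_; flip; case_of_)
open import Function.Bundles using (_⇔_; mk⇔; Equivalence)
open import Relation.Binary.Definitions using (DecidableEquality; Symmetric; Transitive)
import Relation.Binary.Definitions as Binary
open import Relation.Binary.PropositionalEquality hiding ([_])
open import Relation.Nullary using (¬_; yes; no)
open import Relation.Nullary.Decidable using (map′; _⊎-dec_)
open import Relation.Unary using (Decidable)

⊕-self : ∀ {n} (x : Vec Bool n) → zipWith _xor_ x x ≡ replicate n false
⊕-self []      = refl
⊕-self (a ∷ x) = cong₂ _∷_ (xor-same a) (⊕-self x)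

·-distribʳ-⊕ : ∀ {n} (b c : Bool) (x : Vec Bool n) →
               map ((b xor c) ∧_) x ≡ zipWith _xor_ (map (b ∧_) x) (map (c ∧_) x)
·-distribʳ-⊕ b c []      = refl
·-distribʳ-⊕ b c (a ∷ x) = cong₂ _∷_ (∧-distribʳ-xor a b c) (·-distribʳ-⊕ b c x)

module _ {n : ℕ} where

  ⊕-comm : (x y : Vec Bool n) → zipWith _xor_ x y ≡ zipWith _xor_ y x
  ⊕-comm = Vec.zipWith-comm xor-comm

  ⊕-assoc : (x y z : Vec Bool n) →
            zipWith _xor_ (zipWith _xor_ x y) z ≡ zipWith _xor_ x (zipWith _xor_ y z)
  ⊕-assoc = Vec.zipWith-assoc xor-assoc

  ⊕-identityˡ : (x : Vec Bool n) → zipWith _xor_ (replicate n false) x ≡ x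
  ⊕-identityˡ = Vec.zipWith-identityˡ xor-identityˡ

  ⊕-identityʳ : (x : Vec Bool n) → zipWith _xor_ x (replicate n false) ≡ x
  ⊕-identityʳ = Vec.zipWith-identityʳ xor-identityʳ

  ⊕-commutativeSemigroup : CommutativeSemigroup _ _
  ⊕-commutativeSemigroup = record
    { isCommutativeSemigroup = record
      { isSemigroup = record
        { isMagma = record { isEquivalence = isEquivalence ; ∙-cong = cong₂ (zipWith _xor_) }
        ; assoc   = ⊕-assoc
        }
      ; comm = ⊕-comm
      }
    }

  open CommutativeSemigroupProperties ⊕-commutativeSemigroup public
    using () renaming (interchange to ⊕-interchange)

  x⊕[x⊕y]≡y : (x y : Vec Bool n) → zipWith _xor_ x (zipWith _xor_ x y) ≡ y
  x⊕[x⊕y]≡y x y = begin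
    zipWith _xor_ x (zipWith _xor_ x y) ≡⟨ ⊕-assoc x x y ⟨
    zipWith _xor_ (zipWith _xor_ x x) y ≡⟨ cong (λ z → zipWith _xor_ z y) (⊕-self x) ⟩
    zipWith _xor_ (replicate n false) y ≡⟨ ⊕-identityˡ y ⟩
    y                                   ∎
    where open ≡-Reasoning

  x⊕[y⊕x]≡y : (x y : Vec Bool n) → zipWith _xor_ x (zipWith _xor_ y x) ≡ y
  x⊕[y⊕x]≡y x y = trans (cong (zipWith _xor_ x) (⊕-comm y x)) (x⊕[x⊕y]≡y x y)

  ⊕≡0⇒≡ : (x y : Vec Bool n) → zipWith _xor_ x y ≡ replicate n false → x ≡ y
  ⊕≡0⇒≡ x y x⊕y≡0 = begin
    x                                   ≡⟨ ⊕-identityʳ x ⟨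
    zipWith _xor_ x (replicate n false) ≡⟨ cong (zipWith _xor_ x) x⊕y≡0 ⟨
    zipWith _xor_ x (zipWith _xor_ x y) ≡⟨ x⊕[x⊕y]≡y x y ⟩
    y                                   ∎
    where open ≡-Reasoning

  ·-true : (x : Vec Bool n) → map (true ∧_) x ≡ x
  ·-true = Vec.map-id

  ·-false : (x : Vec Bool n) → map (false ∧_) x ≡ replicate n false
  ·-false x = Vec.map-const x false

⊕-injective : ∀ v {x y} → v ⊕ x ≡ v ⊕ y → x ≡ y
⊕-injective v {x} {y} e = trans (sym (x⊕[x⊕y]≡y v x)) (trans (cong (v ⊕_) e) (x⊕[x⊕y]≡y v y))

⊕≢𝟘 : ∀ {x y} → x ≢ y → x ⊕ y ≢ 𝟘
⊕≢𝟘 {x} {y} x≢y = x≢y ∘ ⊕≡0⇒≡ x y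

x≢x⊕y : ∀ {x y} → y ≢ 𝟘 → x ≢ x ⊕ y
x≢x⊕y {x} {y} y≢𝟘 x≡x⊕y =
  y≢𝟘 (trans (sym (x⊕[x⊕y]≡y x y)) (trans (cong (x ⊕_) (sym x≡x⊕y)) (⊕-self x)))

open CommutativeSemigroupProperties (CommutativeRing.+-commutativeSemigroup xor-∧-commutativeRing)
  using () renaming (interchange to xor-interchange)

xor-cancelˡ : ∀ a b → a xor (a xor b) ≡ b
xor-cancelˡ a b = trans (sym (xor-assoc a a b)) (cong (_xor b) (xor-same a))

_≟_ : DecidableEquality V
_≟_ = Vec.≡-dec _≟ᵇ_

open import Data.List.Membership.DecPropositional _≟_ using (_∈?_)

combination : ∀ {n m} → Vec (Vec Bool n) m → Vec Bool m → Vec Bool n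
combination []       []       = replicate _ false
combination (v ∷ vs) (c ∷ cs) = zipWith _xor_ (map (c ∧_) v) (combination vs cs)

combination-⊕ : ∀ {n m} (vs : Vec (Vec Bool n) m) cs ds →
                combination vs (zipWith _xor_ cs ds) ≡
                zipWith _xor_ (combination vs cs) (combination vs ds)
combination-⊕ []       []       []       = sym (⊕-self _)
combination-⊕ (v ∷ vs) (c ∷ cs) (d ∷ ds) =
  trans (cong₂ (zipWith _xor_) (·-distribʳ-⊕ c d v) (combination-⊕ vs cs ds))
        (⊕-interchange (map (c ∧_) v) (map (d ∧_) v) (combination vs cs) (combination vs ds))

module _ {n k} (F : Vec Bool n → Vec Bool k)
         (F-⊕ : ∀ x y → F (zipWith _xor_ x y) ≡ zipWith _xor_ (F x) (F y))
         (F-0 : F (replicate n false) ≡ replicate k false) where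

  F-· : ∀ c x → F (map (c ∧_) x) ≡ map (c ∧_) (F x)
  F-· true  x = trans (cong F (·-true x)) (sym (·-true (F x)))
  F-· false x = trans (cong F (·-false x)) (trans F-0 (sym (·-false (F x))))

  combination-map : ∀ {m} (vs : Vec (Vec Bool n) m) cs →
                    F (combination vs cs) ≡ combination (map F vs) cs
  combination-map []       []       = F-0
  combination-map (v ∷ vs) (c ∷ cs) =
    trans (F-⊕ (map (c ∧_) v) (combination vs cs)) (cong₂ (zipWith _xor_) (F-· c v) (combination-map vs cs))

-- Coefficient vectors are read as binary numerals, so that the pigeonhole principle applies to
-- the 2 ^ m subset sums of m vectors.
private
  bit : Bool → Fin 2
  bit false = Fin.zero
  bit true  = Fin.suc Fin.zero

  unbit : Fin 2 → Bool
  unbit Fin.zero           = false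
  unbit (Fin.suc Fin.zero) = true

  bit-unbit : ∀ i → bit (unbit i) ≡ i
  bit-unbit Fin.zero           = refl
  bit-unbit (Fin.suc Fin.zero) = refl

  bit-injective : ∀ {a b} → bit a ≡ bit b → a ≡ b
  bit-injective {false} {false} _ = refl
  bit-injective {true}  {true}  _ = refl

toFin : ∀ {n} → Vec Bool n → Fin (2 ^ n)
toFin []       = Fin.zero
toFin (b ∷ bs) = combine (bit b) (toFin bs)

fromFin : ∀ {n} → Fin (2 ^ n) → Vec Bool n
fromFin {zero}  _ = []
fromFin {suc n} i = unbit (proj₁ (remQuot {2} (2 ^ n) i)) ∷ fromFin (proj₂ (remQuot {2} (2 ^ n) i))

toFin-injective : ∀ {n} {u v : Vec Bool n} → toFin u ≡ toFin v → u ≡ v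
toFin-injective {u = []}    {[]}    _ = refl
toFin-injective {u = a ∷ u} {b ∷ v} e =
  cong₂ _∷_ (bit-injective (proj₁ heads&tails)) (toFin-injective (proj₂ heads&tails))
  where
  heads&tails : bit a ≡ bit b × toFin u ≡ toFin v
  heads&tails = Fin.combine-injective (bit a) (toFin u) (bit b) (toFin v) e

toFin-fromFin : ∀ {n} (i : Fin (2 ^ n)) → toFin (fromFin {n} i) ≡ i
toFin-fromFin {zero}  Fin.zero = refl
toFin-fromFin {suc n} i =
  trans (cong₂ combine (bit-unbit (proj₁ (remQuot {2} (2 ^ n) i)))
                       (toFin-fromFin {n} (proj₂ (remQuot {2} (2 ^ n) i))))
        (Fin.combine-remQuot {2} (2 ^ n) i)

dependent : ∀ {n m} (vs : Vec (Vec Bool n) m) → n < m →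
            Σ (Vec Bool m) λ cs → cs ≢ replicate m false × combination vs cs ≡ replicate n false
dependent {n} {m} vs n<m
  with Fin.pigeonhole (^-monoʳ-< 2 (s≤s (s≤s z≤n)) n<m) (toFin ∘ combination vs ∘ fromFin)
... | i , j , i<j , same-image = zipWith _xor_ (fromFin i) (fromFin j) , nonzero , vanishes
  where
  nonzero : zipWith _xor_ (fromFin i) (fromFin j) ≢ replicate m false
  nonzero e = Fin.<⇒≢ i<j
    (trans (sym (toFin-fromFin {m} i)) (trans (cong toFin (⊕≡0⇒≡ _ _ e)) (toFin-fromFin {m} j)))
  vanishes : combination vs (zipWith _xor_ (fromFin i) (fromFin j)) ≡ replicate n false
  vanishes = trans (combination-⊕ vs (fromFin i) (fromFin j))
    (trans (cong (zipWith _xor_ _) (sym (toFin-injective same-image))) (⊕-self _))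

lc≡combination : ∀ vs cs → lc vs cs ≡ combination (fromList vs) cs
lc≡combination []       []       = refl
lc≡combination (v ∷ vs) (c ∷ cs) = cong ((c · v) ⊕_) (lc≡combination vs cs)

lc-false : ∀ v vs cs → lc (v ∷ vs) (false ∷ cs) ≡ lc vs cs
lc-false v vs cs = trans (cong (_⊕ lc vs cs) (·-false v)) (⊕-identityˡ (lc vs cs))

lc-true : ∀ v vs cs → lc (v ∷ vs) (true ∷ cs) ≡ v ⊕ lc vs cs
lc-true v vs cs = cong (_⊕ lc vs cs) (·-true v)

InSpan-[]⁻ : ∀ {x} → InSpan [] x → x ≡ 𝟘
InSpan-[]⁻ ([] , 𝟘≡x) = sym 𝟘≡x

InSpan-∷⁺ˡ : ∀ {v vs x} → InSpan vs x → InSpan (v ∷ vs) x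
InSpan-∷⁺ˡ {v} {vs} (cs , e) = false ∷ cs , trans (lc-false v vs cs) e

InSpan-∷⁺ʳ : ∀ {v vs x} → InSpan vs (v ⊕ x) → InSpan (v ∷ vs) x
InSpan-∷⁺ʳ {v} {vs} {x} (cs , e) =
  true ∷ cs , trans (lc-true v vs cs) (trans (cong (v ⊕_) e) (x⊕[x⊕y]≡y v x))

InSpan-∷⁻ : ∀ {v vs x} → InSpan (v ∷ vs) x → InSpan vs x ⊎ InSpan vs (v ⊕ x)
InSpan-∷⁻ {v} {vs} (false ∷ cs , e) = inj₁ (cs , trans (sym (lc-false v vs cs)) e)
InSpan-∷⁻ {v} {vs} (true  ∷ cs , e) =
  inj₂ (cs , trans (sym (x⊕[x⊕y]≡y v (lc vs cs))) (cong (v ⊕_) (trans (sym (lc-true v vs cs)) e)))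

InSpan-𝟘 : ∀ vs → InSpan vs 𝟘
InSpan-𝟘 []       = [] , refl
InSpan-𝟘 (v ∷ vs) = InSpan-∷⁺ˡ (InSpan-𝟘 vs)

InSpan-∈ : ∀ {vs x} → x ∈ vs → InSpan vs x
InSpan-∈ {v ∷ vs} (here refl) = InSpan-∷⁺ʳ (subst (InSpan vs) (sym (⊕-self v)) (InSpan-𝟘 vs))
InSpan-∈ (there x∈vs)         = InSpan-∷⁺ˡ (InSpan-∈ x∈vs)

InSpan-⊕ : ∀ {vs x y} → InSpan vs x → InSpan vs y → InSpan vs (x ⊕ y)
InSpan-⊕ {vs} (cs , refl) (ds , refl) =
  zipWith _xor_ cs ds ,
  trans (lc≡combination vs _)
        (trans (combination-⊕ (fromList vs) cs ds)
               (sym (cong₂ _⊕_ (lc≡combination vs cs) (lc≡combination vs ds))))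

InSpan-⊆ : ∀ {vs ws x} → (∀ {v} → v ∈ vs → InSpan ws v) → InSpan vs x → InSpan ws x
InSpan-⊆ {[]}     {ws} _     x∈⟨vs⟩ = subst (InSpan ws) (sym (InSpan-[]⁻ x∈⟨vs⟩)) (InSpan-𝟘 ws)
InSpan-⊆ {v ∷ vs} {ws} {x} vs⊆ws x∈⟨vs⟩ with InSpan-∷⁻ x∈⟨vs⟩
... | inj₁ x∈⟨vs⟩′   = InSpan-⊆ {vs} {ws} (vs⊆ws ∘ there) x∈⟨vs⟩′
... | inj₂ v⊕x∈⟨vs⟩ =
  subst (InSpan ws) (x⊕[x⊕y]≡y v x)
        (InSpan-⊕ {ws} (vs⊆ws (here refl)) (InSpan-⊆ {vs} {ws} (vs⊆ws ∘ there) v⊕x∈⟨vs⟩))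

InSpan-↭ : ∀ {vs ws x} → vs ↭ ws → InSpan vs x → InSpan ws x
InSpan-↭ {vs} {ws} vs↭ws = InSpan-⊆ {vs} {ws} (InSpan-∈ ∘ ∈-resp-↭ vs↭ws)

InSpan? : ∀ vs → Decidable (InSpan vs)
InSpan? []       x = map′ (λ x≡𝟘 → [] , sym x≡𝟘) InSpan-[]⁻ (x ≟ 𝟘)
InSpan? (v ∷ vs) x =
  map′ [ InSpan-∷⁺ˡ , InSpan-∷⁺ʳ ]′ InSpan-∷⁻ (InSpan? vs x ⊎-dec InSpan? vs (v ⊕ x))

∉⟨point⟩ : ∀ {x y} → y ≢ 𝟘 → y ≢ x → ¬ InSpan (x ∷ []) y
∉⟨point⟩ {x} {y} y≢𝟘 y≢x y∈ =
  [ y≢𝟘 ∘ InSpan-[]⁻ , (λ x⊕y∈ → y≢x (sym (⊕≡0⇒≡ x y (InSpan-[]⁻ x⊕y∈)))) ]′ (InSpan-∷⁻ y∈)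

LinIndep-[] : LinIndep []
LinIndep-[] [] _ = refl

LinIndep-∷ : ∀ {v vs} → LinIndep vs → ¬ InSpan vs v → LinIndep (v ∷ vs)
LinIndep-∷ {v} {vs} indep v∉ (false ∷ cs) e = cong (false ∷_) (indep cs (trans (sym (lc-false v vs cs)) e))
LinIndep-∷ {v} {vs} indep v∉ (true  ∷ cs) e =
  ⊥-elim (v∉ (cs , sym (⊕≡0⇒≡ v (lc vs cs) (trans (sym (lc-true v vs cs)) e))))

LinIndep-∷⁻ : ∀ {v vs} → LinIndep (v ∷ vs) → LinIndep vs × ¬ InSpan vs v
LinIndep-∷⁻ {v} {vs} indep =
  (λ cs e → Vec.∷-injectiveʳ (indep (false ∷ cs) (trans (lc-false v vs cs) e))) ,
  (λ { (cs , refl) → case Vec.∷-injectiveˡ (indep (true ∷ cs) (trans (lc-true v vs cs) (⊕-self _))) of λ () })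

-- Independence of vs ∷ʳ v reduces to that of v ∷ vs, since both lists have the same span.
LinIndep-∷ʳ : ∀ {v vs} → LinIndep vs → ¬ InSpan vs v → LinIndep (vs ∷ʳ v)
LinIndep-∷ʳ {v} {[]}     indep v∉ = LinIndep-∷ indep v∉
LinIndep-∷ʳ {v} {w ∷ ws} indep v∉ = LinIndep-∷ (LinIndep-∷ʳ {v} {ws} ws-indep (v∉ ∘ InSpan-∷⁺ˡ)) w∉
  where
  ws-indep : LinIndep ws
  ws-indep = proj₁ (LinIndep-∷⁻ indep)
  snoc⊆cons : ∀ {x} → x ∈ ws ∷ʳ v → InSpan (v ∷ ws) x
  snoc⊆cons {x} x∈ with ∈-++⁻ ws x∈
  ... | inj₁ x∈ws        = InSpan-∈ (there x∈ws)
  ... | inj₂ (here refl) = InSpan-∈ (here refl)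
  w∉ : ¬ InSpan (ws ∷ʳ v) w
  w∉ w∈ with InSpan-∷⁻ (InSpan-⊆ snoc⊆cons w∈)
  ... | inj₁ w∈⟨ws⟩   = proj₂ (LinIndep-∷⁻ indep) w∈⟨ws⟩
  ... | inj₂ v⊕w∈⟨ws⟩ = v∉ (InSpan-∷⁺ʳ (subst (InSpan ws) (⊕-comm v w) v⊕w∈⟨ws⟩))

spanList : List V → List V
spanList []       = 𝟘 ∷ []
spanList (v ∷ vs) = spanList vs ++ List.map (v ⊕_) (spanList vs)

∈-map-⊕ : ∀ {v x xs} → x ∈ List.map (v ⊕_) xs → v ⊕ x ∈ xs
∈-map-⊕ {v} x∈ with ∈-map⁻ (v ⊕_) x∈
... | y , y∈ , refl = subst (_∈ _) (sym (x⊕[x⊕y]≡y v y)) y∈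

∈spanList⇔InSpan : ∀ vs {x} → x ∈ spanList vs ⇔ InSpan vs x
∈spanList⇔InSpan []           = mk⇔ (λ { (here refl) → [] , refl }) (here ∘ InSpan-[]⁻)
∈spanList⇔InSpan (v ∷ vs) {x} = mk⇔ to from
  where
  to′ : ∀ {y} → y ∈ spanList vs → InSpan vs y
  to′ = Equivalence.to (∈spanList⇔InSpan vs)
  from′ : ∀ {y} → InSpan vs y → y ∈ spanList vs
  from′ = Equivalence.from (∈spanList⇔InSpan vs)
  to : x ∈ spanList (v ∷ vs) → InSpan (v ∷ vs) x
  to = [ InSpan-∷⁺ˡ ∘ to′ , InSpan-∷⁺ʳ ∘ to′ ∘ ∈-map-⊕ ]′ ∘ ∈-++⁻ (spanList vs)
  from : InSpan (v ∷ vs) x → x ∈ spanList (v ∷ vs)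
  from = [ ∈-++⁺ˡ ∘ from′
         , ∈-++⁺ʳ (spanList vs) ∘ subst (_∈ _) (x⊕[x⊕y]≡y v x) ∘ ∈-map⁺ (v ⊕_) ∘ from′
         ]′ ∘ InSpan-∷⁻

spanList-unique : ∀ {vs} → LinIndep vs → Unique (spanList vs)
spanList-unique {[]}     _     = [] AllPairs.∷ AllPairs.[]
spanList-unique {v ∷ vs} indep =
  Unique.++⁺ unique (Unique.map⁺ (⊕-injective v) unique) disjoint
  where
  unique = spanList-unique {vs} (proj₁ (LinIndep-∷⁻ {v} {vs} indep))
  disjoint : Disjoint (spanList vs) (List.map (v ⊕_) (spanList vs))
  disjoint {x} (x∈ , x∈map) =
    proj₂ (LinIndep-∷⁻ {v} {vs} indep)
      (subst (InSpan vs) (x⊕[y⊕x]≡y x v)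
             (InSpan-⊕ {vs} (Equivalence.to (∈spanList⇔InSpan vs) x∈)
                            (Equivalence.to (∈spanList⇔InSpan vs) (∈-map-⊕ x∈map))))

basis : ∀ n → Vec (Vec Bool n) n
basis zero    = []
basis (suc n) = (true ∷ replicate n false) ∷ map (false ∷_) (basis n)

combination-false∷ : ∀ {n m} (vs : Vec (Vec Bool n) m) cs →
                     combination (map (false ∷_) vs) cs ≡ false ∷ combination vs cs
combination-false∷ []       []       = refl
combination-false∷ (v ∷ vs) (c ∷ cs) =
  trans (cong (zipWith _xor_ _) (combination-false∷ vs cs))
        (cong (_∷ zipWith _xor_ (map (c ∧_) v) (combination vs cs)) (trans (xor-identityʳ _) (∧-zeroʳ c)))

combination-basis : ∀ {n} (x : Vec Bool n) → combination (basis n) x ≡ x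
combination-basis             []      = refl
combination-basis {suc n} (b ∷ x) =
  trans (cong (zipWith _xor_ _) (combination-false∷ (basis n) x))
        (cong₂ _∷_ (trans (xor-identityʳ _) (∧-identityʳ b))
                   (trans (cong (λ z → zipWith _xor_ z (combination (basis n) x))
                                (trans (Vec.map-replicate (b ∧_) false n) (cong (replicate n) (∧-zeroʳ b))))
                          (trans (⊕-identityˡ _) (combination-basis x))))

InSpan-basis : ∀ x → InSpan (toList (basis 8)) x
InSpan-basis x = x , trans (lc≡combination (toList (basis 8)) x) (combination-basis x)

extend : ∀ es {ys} → LinIndep ys → Σ (List V) λ zs → LinIndep (zs ++ ys) × All (InSpan (zs ++ ys)) es
extend []       ys-indep = [] , ys-indep , []
extend (e ∷ es) {ys} ys-indep with InSpan? ys e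
... | yes e∈⟨ys⟩ =
  let zs , indep , spans = extend es ys-indep
  in  zs , indep , InSpan-⊆ {ys} {zs ++ ys} (InSpan-∈ ∘ ∈-++⁺ʳ zs) e∈⟨ys⟩ ∷ spans
... | no  e∉⟨ys⟩ =
  let zs , indep , spans = extend es (LinIndep-∷ ys-indep e∉⟨ys⟩)
      reassoc : zs ++ e ∷ ys ≡ (zs ∷ʳ e) ++ ys
      reassoc = sym (++-assoc zs [ e ] ys)
  in  zs ∷ʳ e , subst LinIndep reassoc indep ,
      subst (λ L → All (InSpan L) (e ∷ es)) reassoc (InSpan-∈ (∈-++⁺ʳ zs (here refl)) ∷ spans)

extend-to-basis : ∀ {ys} → LinIndep ys →
                  Σ (List V) λ zs → LinIndep (zs ++ ys) × (∀ x → InSpan (zs ++ ys) x)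
extend-to-basis {ys} ys-indep =
  let zs , indep , spans = extend (toList (basis 8)) {ys} ys-indep
  in  zs , indep , InSpan-⊆ {toList (basis 8)} {zs ++ ys} (All.lookup spans) ∘ InSpan-basis

LinIndep⇒length≤8 : ∀ {vs} → LinIndep vs → length vs ≤ 8
LinIndep⇒length≤8 {vs} indep with length vs ≤? 8
... | yes ≤8 = ≤8
... | no  ≰8 =
  let cs , cs≢0 , vanishes = dependent (fromList vs) (≰⇒> ≰8)
  in  ⊥-elim (cs≢0 (indep cs (trans (lc≡combination vs cs) vanishes)))

xorsum-++ : ∀ xs ys → xorsum (xs ++ ys) ≡ xorsum xs xor xorsum ys
xorsum-++ []       ys = refl
xorsum-++ (x ∷ xs) ys = trans (cong (x xor_) (xorsum-++ xs ys)) (sym (xor-assoc x (xorsum xs) (xorsum ys)))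

module _ {I : Set} where

  xorsum-map-xor : ∀ (f g : I → Bool) is →
                   xorsum (List.map (λ i → f i xor g i) is) ≡
                   xorsum (List.map f is) xor xorsum (List.map g is)
  xorsum-map-xor f g []       = refl
  xorsum-map-xor f g (i ∷ is) =
    trans (cong ((f i xor g i) xor_) (xorsum-map-xor f g is))
          (xor-interchange (f i) (g i) (xorsum (List.map f is)) (xorsum (List.map g is)))

  xorsum-concatMap : ∀ (h : I → List Bool) is → xorsum (concatMap h is) ≡ xorsum (List.map (xorsum ∘ h) is)
  xorsum-concatMap h []       = refl
  xorsum-concatMap h (i ∷ is) = trans (xorsum-++ (h i) _) (cong (xorsum (h i) xor_) (xorsum-concatMap h is))

∑ : (Fin 8 → Fin 8 → Bool) → Bool
∑ F = xorsum (concatMap (λ i → List.map (F i) (allFin 8)) (allFin 8))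

∑-cong : ∀ {F G} → (∀ i j → F i j ≡ G i j) → ∑ F ≡ ∑ G
∑-cong F≗G = cong xorsum (List.concatMap-cong (λ i → List.map-cong (F≗G i) (allFin 8)) (allFin 8))

∑-xor : ∀ F G → ∑ (λ i j → F i j xor G i j) ≡ ∑ F xor ∑ G
∑-xor F G = begin
  ∑ (λ i j → F i j xor G i j)
    ≡⟨ xorsum-concatMap (λ i → List.map (λ j → F i j xor G i j) (allFin 8)) (allFin 8) ⟩
  xorsum (List.map (λ i → xorsum (List.map (λ j → F i j xor G i j) (allFin 8))) (allFin 8))
    ≡⟨ cong xorsum (List.map-cong (λ i → xorsum-map-xor (F i) (G i) (allFin 8)) (allFin 8)) ⟩
  xorsum (List.map (λ i → row F i xor row G i) (allFin 8))
    ≡⟨ xorsum-map-xor (row F) (row G) (allFin 8) ⟩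
  xorsum (List.map (row F) (allFin 8)) xor xorsum (List.map (row G) (allFin 8))
    ≡⟨ cong₂ _xor_ (xorsum-concatMap (λ i → List.map (F i) (allFin 8)) (allFin 8))
                   (xorsum-concatMap (λ i → List.map (G i) (allFin 8)) (allFin 8)) ⟨
  ∑ F xor ∑ G
    ∎
  where
  open ≡-Reasoning
  row : (Fin 8 → Fin 8 → Bool) → Fin 8 → Bool
  row H i = xorsum (List.map (H i) (allFin 8))

polar-product : ∀ a b c d → ((a xor b) ∧ (c xor d)) xor ((a ∧ c) xor (b ∧ d)) ≡ (a ∧ d) xor (b ∧ c)
polar-product false false c d = refl
polar-product false true  c d = trans (xor-assoc c d d) (trans (cong (c xor_) (xor-same d)) (xor-identityʳ c))
polar-product true  false c d =
  trans (cong ((c xor d) xor_) (xor-identityʳ c))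
        (trans (cong (_xor c) (xor-comm c d)) (trans (xor-assoc d c c) (cong (d xor_) (xor-same c))))
polar-product true  true  c d = xor-comm c d

module QuadraticForm (c : Coeffs) where

  q : V → Bool
  q = evalQ c

  B : V → V → Bool
  B = polar c

  Orthogonal : List V → List V → Set
  Orthogonal xs ys = ∀ {x y} → x ∈ xs → y ∈ ys → B x y ≡ false

  q-⊕ : ∀ x y → q (x ⊕ y) ≡ (q x xor q y) xor B x y
  q-⊕ x y = sym (trans (cong ((q x xor q y) xor_) (xor-comm (q (x ⊕ y)) (q x xor q y)))
                       (xor-cancelˡ (q x xor q y) (q (x ⊕ y))))

  B-sym : ∀ x y → B x y ≡ B y x
  B-sym x y = cong₂ _xor_ (cong q (⊕-comm x y)) (xor-comm (q x) (q y))

  -- β i j is the polarisation of the monomial c i j x_i x_j of q.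
  β : Fin 8 → Fin 8 → V → V → Bool
  β i j x y = if toℕ i ≤ᵇ toℕ j
              then c i j ∧ ((lookup x i ∧ lookup y j) xor (lookup y i ∧ lookup x j))
              else false

  private
    monomial : Fin 8 → Fin 8 → V → Bool
    monomial i j x = if toℕ i ≤ᵇ toℕ j then c i j ∧ (lookup x i ∧ lookup x j) else false

    monomial-polar : ∀ i j x y → monomial i j (x ⊕ y) xor (monomial i j x xor monomial i j y) ≡ β i j x y
    monomial-polar i j x y
      rewrite Vec.lookup-zipWith _xor_ i x y | Vec.lookup-zipWith _xor_ j x y with toℕ i ≤ᵇ toℕ j
    ... | false = refl
    ... | true  = begin
      (c i j ∧ ((xi xor yi) ∧ (xj xor yj))) xor ((c i j ∧ (xi ∧ xj)) xor (c i j ∧ (yi ∧ yj)))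
        ≡⟨ cong ((c i j ∧ ((xi xor yi) ∧ (xj xor yj))) xor_) (∧-distribˡ-xor (c i j) (xi ∧ xj) (yi ∧ yj)) ⟨
      (c i j ∧ ((xi xor yi) ∧ (xj xor yj))) xor (c i j ∧ ((xi ∧ xj) xor (yi ∧ yj)))
        ≡⟨ ∧-distribˡ-xor (c i j) ((xi xor yi) ∧ (xj xor yj)) ((xi ∧ xj) xor (yi ∧ yj)) ⟨
      c i j ∧ (((xi xor yi) ∧ (xj xor yj)) xor ((xi ∧ xj) xor (yi ∧ yj)))
        ≡⟨ cong (c i j ∧_) (polar-product xi yi xj yj) ⟩
      c i j ∧ ((xi ∧ yj) xor (yi ∧ xj))
        ∎
      where
      open ≡-Reasoning
      xi xj yi yj : Bool
      xi = lookup x i; xj = lookup x j; yi = lookup y i; yj = lookup y j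

  B≡∑β : ∀ x y → B x y ≡ ∑ (λ i j → β i j x y)
  B≡∑β x y = begin
    q (x ⊕ y) xor (q x xor q y)
      ≡⟨ cong (q (x ⊕ y) xor_) (∑-xor (λ i j → monomial i j x) (λ i j → monomial i j y)) ⟨
    q (x ⊕ y) xor ∑ (λ i j → monomial i j x xor monomial i j y)
      ≡⟨ ∑-xor (λ i j → monomial i j (x ⊕ y)) (λ i j → monomial i j x xor monomial i j y) ⟨
    ∑ (λ i j → monomial i j (x ⊕ y) xor (monomial i j x xor monomial i j y))
      ≡⟨ ∑-cong (λ i j → monomial-polar i j x y) ⟩
    ∑ (λ i j → β i j x y)
      ∎
    where open ≡-Reasoning

  β-⊕ʳ : ∀ i j x y z → β i j x (y ⊕ z) ≡ β i j x y xor β i j x z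
  β-⊕ʳ i j x y z
    rewrite Vec.lookup-zipWith _xor_ i y z | Vec.lookup-zipWith _xor_ j y z with toℕ i ≤ᵇ toℕ j
  ... | false = refl
  ... | true  = begin
    c i j ∧ ((xi ∧ (yj xor zj)) xor ((yi xor zi) ∧ xj))
      ≡⟨ cong (c i j ∧_) (cong₂ _xor_ (∧-distribˡ-xor xi yj zj) (∧-distribʳ-xor xj yi zi)) ⟩
    c i j ∧ (((xi ∧ yj) xor (xi ∧ zj)) xor ((yi ∧ xj) xor (zi ∧ xj)))
      ≡⟨ cong (c i j ∧_) (xor-interchange (xi ∧ yj) (xi ∧ zj) (yi ∧ xj) (zi ∧ xj)) ⟩
    c i j ∧ (((xi ∧ yj) xor (yi ∧ xj)) xor ((xi ∧ zj) xor (zi ∧ xj)))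
      ≡⟨ ∧-distribˡ-xor (c i j) ((xi ∧ yj) xor (yi ∧ xj)) ((xi ∧ zj) xor (zi ∧ xj)) ⟩
    (c i j ∧ ((xi ∧ yj) xor (yi ∧ xj))) xor (c i j ∧ ((xi ∧ zj) xor (zi ∧ xj)))
      ∎
    where
    open ≡-Reasoning
    xi xj yi yj zi zj : Bool
    xi = lookup x i; xj = lookup x j; yi = lookup y i; yj = lookup y j; zi = lookup z i; zj = lookup z j

  B-⊕ʳ : ∀ x y z → B x (y ⊕ z) ≡ B x y xor B x z
  B-⊕ʳ x y z = begin
    B x (y ⊕ z)                                     ≡⟨ B≡∑β x (y ⊕ z) ⟩
    ∑ (λ i j → β i j x (y ⊕ z))                     ≡⟨ ∑-cong (λ i j → β-⊕ʳ i j x y z) ⟩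
    ∑ (λ i j → β i j x y xor β i j x z)             ≡⟨ ∑-xor (λ i j → β i j x y) (λ i j → β i j x z) ⟩
    ∑ (λ i j → β i j x y) xor ∑ (λ i j → β i j x z) ≡⟨ cong₂ _xor_ (B≡∑β x y) (B≡∑β x z) ⟨
    B x y xor B x z                                 ∎
    where open ≡-Reasoning

  B-⊕ˡ : ∀ x y z → B (x ⊕ y) z ≡ B x z xor B y z
  B-⊕ˡ x y z = trans (B-sym (x ⊕ y) z) (trans (B-⊕ʳ z x y) (cong₂ _xor_ (B-sym z x) (B-sym z y)))

  B-𝟘ʳ : ∀ x → B x 𝟘 ≡ false
  B-𝟘ʳ x = trans (B-⊕ʳ x 𝟘 𝟘) (xor-same (B x 𝟘))

  B-𝟘ˡ : ∀ x → B 𝟘 x ≡ false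
  B-𝟘ˡ x = trans (B-sym 𝟘 x) (B-𝟘ʳ x)

  q-𝟘 : q 𝟘 ≡ false
  q-𝟘 = trans (sym (trans (cong (q 𝟘 xor_) (xor-same (q 𝟘))) (xor-identityʳ (q 𝟘)))) (B-𝟘ʳ 𝟘)

  B-self : ∀ x → B x x ≡ false
  B-self x = cong₂ _xor_ (trans (cong q (⊕-self x)) q-𝟘) (xor-same (q x))

  q-⊕-singular : ∀ {x y} → q x ≡ false → q y ≡ false → q (x ⊕ y) ≡ B x y
  q-⊕-singular {x} {y} qx qy = trans (q-⊕ x y) (cong₂ (λ a b → (a xor b) xor B x y) qx qy)

  q-⊕-radical : ∀ {x y} → q y ≡ false → B x y ≡ false → q (x ⊕ y) ≡ q x
  q-⊕-radical {x} {y} qy Bxy =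
    trans (q-⊕ x y) (trans (cong₂ (λ a b → (q x xor a) xor b) qy Bxy)
                           (trans (xor-identityʳ _) (xor-identityʳ (q x))))

  ⊥-span : ∀ {x vs y} → (∀ {v} → v ∈ vs → B x v ≡ false) → InSpan vs y → B x y ≡ false
  ⊥-span {x} {[]}              _    y∈ = trans (cong (B x) (InSpan-[]⁻ y∈)) (B-𝟘ʳ x)
  ⊥-span {x} {v ∷ vs} {y} x⊥vs y∈ = [ x⊥⟨vs⟩ , x⊥v⊕ ]′ (InSpan-∷⁻ y∈)
    where
    x⊥⟨vs⟩ : ∀ {z} → InSpan vs z → B x z ≡ false
    x⊥⟨vs⟩ = ⊥-span {x} {vs} (x⊥vs ∘ there)
    x⊥v⊕ : InSpan vs (v ⊕ y) → B x y ≡ false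
    x⊥v⊕ v⊕y∈⟨vs⟩ = begin
      B x y                   ≡⟨ cong (B x) (x⊕[x⊕y]≡y v y) ⟨
      B x (v ⊕ (v ⊕ y))       ≡⟨ B-⊕ʳ x v (v ⊕ y) ⟩
      B x v xor B x (v ⊕ y)   ≡⟨ cong₂ _xor_ (x⊥vs (here refl)) (x⊥⟨vs⟩ v⊕y∈⟨vs⟩) ⟩
      false                   ∎
      where open ≡-Reasoning

module _ {A : Set} where

  map-xor : ∀ {n} (f g : A → Bool) (v : Vec A n) →
            map (λ a → f a xor g a) v ≡ zipWith _xor_ (map f v) (map g v)
  map-xor f g []      = refl
  map-xor f g (a ∷ v) = cong ((f a xor g a) ∷_) (map-xor f g v)

  map-fromList≡0 : ∀ (f : A → Bool) as → map f (fromList as) ≡ replicate (length as) false →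
                   ∀ {a} → a ∈ as → f a ≡ false
  map-fromList≡0 f (a ∷ as) f≡0 (here refl) = Vec.∷-injectiveˡ f≡0
  map-fromList≡0 f (a ∷ as) f≡0 (there a∈)  = map-fromList≡0 f as (Vec.∷-injectiveʳ f≡0) a∈

module NonDegenerateForm (c : Coeffs) (nd : NonDegenerate c) where

  open QuadraticForm c

  -- Extend ys to a basis zs ++ ys. If xs were longer than zs, the vectors (B x z)_{z ∈ zs},
  -- x ∈ xs, would be dependent, giving a nonzero x ∈ ⟨xs⟩ orthogonal to everything.
  orthogonal-independent-bound : ∀ {xs ys} → LinIndep xs → LinIndep ys → Orthogonal xs ys →
                                 length xs + length ys ≤ 8
  orthogonal-independent-bound {xs} {ys} xs-indep ys-indep xs⊥ys with extend-to-basis {ys} ys-indep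
  ... | zs , basis-indep , spanning =
    ≤-trans (+-monoˡ-≤ (length ys) xs≤zs)
            (subst (_≤ 8) (length-++ zs) (LinIndep⇒length≤8 {zs ++ ys} basis-indep))
    where
    F : V → Vec Bool (length zs)
    F x = map (B x) (fromList zs)

    F-⊕ : ∀ x y → F (x ⊕ y) ≡ zipWith _xor_ (F x) (F y)
    F-⊕ x y = trans (Vec.map-cong (B-⊕ˡ x y) (fromList zs)) (map-xor (B x) (B y) (fromList zs))

    F-𝟘 : F 𝟘 ≡ replicate (length zs) false
    F-𝟘 = trans (Vec.map-cong B-𝟘ˡ (fromList zs)) (Vec.map-const (fromList zs) false)

    xs≤zs : length xs ≤ length zs
    xs≤zs with length xs ≤? length zs
    ... | yes ≤ = ≤
    ... | no  ≰ with dependent (map F (fromList xs)) (≰⇒> ≰)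
    ...   | cs , cs≢0 , vanishes = ⊥-elim (cs≢0 (xs-indep cs x≡𝟘))
      where
      x : V
      x = lc xs cs
      Fx≡0 : F x ≡ replicate (length zs) false
      Fx≡0 = trans (cong F (lc≡combination xs cs))
                   (trans (combination-map F F-⊕ F-𝟘 (fromList xs) cs) vanishes)
      x⊥zs++ys : ∀ {v} → v ∈ zs ++ ys → B x v ≡ false
      x⊥zs++ys {v} v∈ =
        [ map-fromList≡0 (B x) zs Fx≡0
        , (λ v∈ys → trans (B-sym x v)
                          (⊥-span {v} {xs} {x} (λ {u} u∈ → trans (B-sym v u) (xs⊥ys u∈ v∈ys)) (cs , refl)))
        ]′ (∈-++⁻ zs v∈)
      x≡𝟘 : x ≡ 𝟘
      x≡𝟘 = nd x (λ y → ⊥-span {x} {zs ++ ys} {y} x⊥zs++ys (spanning y))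

  ⊥-complement-spanned : ∀ {xs ys} → LinIndep xs → LinIndep ys → Orthogonal xs ys →
                         length xs + length ys ≡ 8 →
                         ∀ {z} → (∀ {y} → y ∈ ys → B z y ≡ false) → InSpan xs z
  ⊥-complement-spanned {xs} {ys} xs-indep ys-indep xs⊥ys total {z} z⊥ys with InSpan? xs z
  ... | yes z∈⟨xs⟩ = z∈⟨xs⟩
  ... | no  z∉⟨xs⟩ =
    ⊥-elim (1+n≰n (subst (_≤ 8) (cong suc total)
      (orthogonal-independent-bound (LinIndep-∷ xs-indep z∉⟨xs⟩) ys-indep z∷xs⊥ys)))
    where
    z∷xs⊥ys : Orthogonal (z ∷ xs) ys
    z∷xs⊥ys (here refl) y∈ = z⊥ys y∈
    z∷xs⊥ys (there x∈)  y∈ = xs⊥ys x∈ y∈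

module Cliques (c : Coeffs) (Π : List V) where

  open Geometry c Π

  IsClique-resp-↭ : ∀ {xs ys} → xs ↭ ys → IsClique xs → IsClique ys
  IsClique-resp-↭ xs↭ys (unique , vertices , adjacent) =
    PermutationSetoid.AllPairs-resp-↭ (setoid V) (λ x≢y → x≢y ∘ sym) (resp₂ _≢_) (↭⇒↭ₛ xs↭ys) unique ,
    All-resp-↭ xs↭ys vertices ,
    λ x y x∈ y∈ → adjacent x y (∈-resp-↭ (↭-sym xs↭ys) x∈) (∈-resp-↭ (↭-sym xs↭ys) y∈)

  AdjacentToAll : List V → V → Set
  AdjacentToAll S v = ∀ s → s ∈ S → v ≢ s → Adj v s

  unique-maximal-clique :
    ∀ {K S} → IsClique K → All (_∈ K) S → (∀ v → IsVertex v → AdjacentToAll S v → v ∈ K) →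
    IsMaximalClique K × (∀ K′ → IsMaximalClique K′ → All (_∈ K′) S → ∀ x → x ∈ K′ ⇔ x ∈ K)
  unique-maximal-clique {K} {S} K-clique@(_ , K-vertices , K-adjacent) S⊆K closed =
    (K-clique , maximal) , unique
    where
    maximal : ∀ v → IsVertex v → v ∉ K → ¬ (∀ w → w ∈ K → Adj v w)
    maximal v v-vertex v∉K adj = v∉K (closed v v-vertex (λ s s∈ _ → adj s (All.lookup S⊆K s∈)))

    unique : ∀ K′ → IsMaximalClique K′ → All (_∈ K′) S → ∀ x → x ∈ K′ ⇔ x ∈ K
    unique K′ ((_ , K′-vertices , K′-adjacent) , K′-maximal) S⊆K′ x = mk⇔ K′⊆K K⊆K′
      where
      K′⊆K : ∀ {y} → y ∈ K′ → y ∈ K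
      K′⊆K {y} y∈ = closed y (All.lookup K′-vertices y∈) (λ s s∈ → K′-adjacent y s y∈ (All.lookup S⊆K′ s∈))
      K⊆K′ : x ∈ K → x ∈ K′
      K⊆K′ x∈ with x ∈? K′
      ... | yes x∈′ = x∈′
      ... | no  x∉′ = ⊥-elim (K′-maximal x (All.lookup K-vertices x∈) x∉′
                                (λ w w∈ → K-adjacent x w x∈ (K′⊆K w∈) (λ { refl → x∉′ w∈ })))

module TwoClasses {A : Set} {_≈_ : A → A → Set} (≈-refl : ∀ {x} → x ≈ x)
                  (≈-sym : Symmetric _≈_) (≈-trans : Transitive _≈_) (_≈?_ : Binary.Decidable _≈_) where

  pairs : A → A → A → List (A × A)
  pairs x y z = (x , y) ∷ (x , z) ∷ (y , z) ∷ []

  -- x and w represent the two classes; t is the third element.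
  record Split (x y z : A) : Set where
    field
      w t     : A
      y∷z↭w∷t : y ∷ z ∷ [] ↭ w ∷ t ∷ []
      x≉w     : ¬ x ≈ w
      t-class : t ≈ x ⊎ t ≈ w

  split : ∀ x y z → Any (λ p → proj₁ p ≈ proj₂ p) (pairs x y z) →
          Any (λ p → ¬ proj₁ p ≈ proj₂ p) (pairs x y z) → Split x y z
  split x y z related unrelated with x ≈? y
  ... | no x≉y = record { w = y ; t = z ; y∷z↭w∷t = ↭-refl ; x≉w = x≉y ; t-class = z-class related }
    where
    z-class : Any (λ p → proj₁ p ≈ proj₂ p) (pairs x y z) → z ≈ x ⊎ z ≈ y
    z-class (here x≈y)                 = ⊥-elim (x≉y x≈y)
    z-class (there (here x≈z))         = inj₁ (≈-sym x≈z)
    z-class (there (there (here y≈z))) = inj₂ (≈-sym y≈z)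
  ... | yes x≈y = record { w = z ; t = y ; y∷z↭w∷t = swap y z ↭-refl ; x≉w = x≉z unrelated
                         ; t-class = inj₁ (≈-sym x≈y) }
    where
    x≉z : Any (λ p → ¬ proj₁ p ≈ proj₂ p) (pairs x y z) → ¬ x ≈ z
    x≉z (here x≉y)                 = ⊥-elim (x≉y x≈y)
    x≉z (there (here x≉z))         = x≉z
    x≉z (there (there (here y≉z))) = y≉z ∘ ≈-trans (≈-sym x≈y)

  module _ {x y z} (s : Split x y z) where

    open Split s

    member-class : ∀ {u} → u ∈ x ∷ y ∷ z ∷ [] → u ≈ x ⊎ u ≈ w
    member-class (here refl) = inj₁ ≈-refl
    member-class (there u∈) with ∈-resp-↭ y∷z↭w∷t u∈
    ... | here refl         = inj₂ ≈-refl
    ... | there (here refl) = t-class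

    related-class : ∀ {v} → Any (v ≈_) (x ∷ y ∷ z ∷ []) → v ≈ x ⊎ v ≈ w
    related-class v≈any with find v≈any
    ... | u , u∈ , v≈u = Sum.map (≈-trans v≈u) (≈-trans v≈u) (member-class u∈)

no-three-in-two : ∀ {A : Set} {a b x y z : A} → x ≢ y → x ≢ z → y ≢ z →
                  x ≡ a ⊎ x ≡ b → y ≡ a ⊎ y ≡ b → z ≡ a ⊎ z ≡ b → ⊥
no-three-in-two x≢y _   _   (inj₁ refl) (inj₁ refl) _           = x≢y refl
no-three-in-two x≢y _   _   (inj₂ refl) (inj₂ refl) _           = x≢y refl
no-three-in-two _   x≢z _   (inj₁ refl) (inj₂ refl) (inj₁ refl) = x≢z refl
no-three-in-two _   _   y≢z (inj₁ refl) (inj₂ refl) (inj₂ refl) = y≢z refl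
no-three-in-two _   _   y≢z (inj₂ refl) (inj₁ refl) (inj₁ refl) = y≢z refl
no-three-in-two _   x≢z _   (inj₂ refl) (inj₁ refl) (inj₂ refl) = x≢z refl

module Generator (c : Coeffs) (nd : NonDegenerate c) (Π : List V) (|Π|≡4 : length Π ≡ 4)
                 (Π-indep : LinIndep Π) (Π-singular : (x : V) → InSpan Π x → evalQ c x ≡ false) where

  open QuadraticForm c
  open NonDegenerateForm c nd
  open Geometry c Π
  open Cliques c Π

  Π-isotropic : ∀ {x y} → InΠ x → InΠ y → B x y ≡ false
  Π-isotropic {x} {y} x∈Π y∈Π =
    trans (sym (q-⊕-singular {x} {y} (Π-singular x x∈Π) (Π-singular y y∈Π)))
          (Π-singular (x ⊕ y) (InSpan-⊕ {Π} x∈Π y∈Π))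

  infix 4 _≈_ _≈?_

  _≈_ : V → V → Set
  x ≈ y = InΠ (x ⊕ y)

  ≈-refl : ∀ {x} → x ≈ x
  ≈-refl {x} = subst InΠ (sym (⊕-self x)) (InSpan-𝟘 Π)

  ≈-sym : Symmetric _≈_
  ≈-sym {x} {y} = subst InΠ (⊕-comm x y)

  ≈-trans : Transitive _≈_
  ≈-trans {x} {y} {z} x≈y y≈z =
    subst InΠ (trans (⊕-assoc x y (y ⊕ z)) (cong (x ⊕_) (x⊕[x⊕y]≡y y z))) (InSpan-⊕ {Π} x≈y y≈z)

  _≈?_ : Binary.Decidable _≈_
  x ≈? y = InSpan? Π (x ⊕ y)

  open TwoClasses ≈-refl ≈-sym ≈-trans _≈?_ public

  ≈⇒B≡false : ∀ {x y} → IsVertex x → IsVertex y → x ≈ y → B x y ≡ false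
  ≈⇒B≡false {x} {y} ((_ , qx) , _) ((_ , qy) , _) x≈y =
    trans (sym (q-⊕-singular {x} {y} qx qy)) (Π-singular (x ⊕ y) x≈y)

  B≡true⇒≉ : ∀ {x y} → IsVertex x → IsVertex y → B x y ≡ true → ¬ x ≈ y
  B≡true⇒≉ x-vertex y-vertex Bxy≡true x≈y =
    case trans (sym Bxy≡true) (≈⇒B≡false x-vertex y-vertex x≈y) of λ ()

  ∼₁⇒B≡true : ∀ {x y} → IsVertex x → IsVertex y → x ≢ y → x ∼₁ y → B x y ≡ true
  ∼₁⇒B≡true {x} {y} ((x≢𝟘 , qx) , _) ((y≢𝟘 , qy) , _) x≢y (_ , _ , _ , _ , _ , _ , _ , on-line) =
    ¬-not λ Bxy≡false →
      no-three-in-two x≢y (x≢x⊕y y≢𝟘) (x≢x⊕y {y} {x} x≢𝟘 ∘ flip trans (⊕-comm x y))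
        (on-line x (here refl) (x≢𝟘 , qx))
        (on-line y (there (here refl)) (y≢𝟘 , qy))
        (on-line (x ⊕ y) (there (there (here refl))) (⊕≢𝟘 x≢y , trans (q-⊕-singular {x} {y} qx qy) Bxy≡false))

  ∼₂⇒≈ : ∀ {x y} → IsVertex x → IsVertex y → x ∼₂ y → x ≈ y
  ∼₂⇒≈ (_ , x∉Π) _        (_ , _ , here refl , x∈Π , _)                 = ⊥-elim (x∉Π x∈Π)
  ∼₂⇒≈ _        (_ , y∉Π) (_ , _ , there (here refl) , y∈Π , _)         = ⊥-elim (y∉Π y∈Π)
  ∼₂⇒≈ _        _        (_ , _ , there (there (here refl)) , x⊕y∈Π , _) = x⊕y∈Π

  Adj⇒B≡true⊎≈ : ∀ {x y} → Adj x y → B x y ≡ true ⊎ x ≈ y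
  Adj⇒B≡true⊎≈ (x-vertex , y-vertex , x≢y , inj₁ secant)  = inj₁ (∼₁⇒B≡true x-vertex y-vertex x≢y secant)
  Adj⇒B≡true⊎≈ (x-vertex , y-vertex , x≢y , inj₂ tangent) = inj₂ (∼₂⇒≈ x-vertex y-vertex tangent)

  Adj-≉⇒B≡true : ∀ {x y} → Adj x y → ¬ x ≈ y → B x y ≡ true
  Adj-≉⇒B≡true adj x≉y = [ (λ Bxy≡true → Bxy≡true) , ⊥-elim ∘ x≉y ]′ (Adj⇒B≡true⊎≈ adj)

  B≡true⇒Adj : ∀ {x y} → IsVertex x → IsVertex y → x ≢ y → B x y ≡ true → Adj x y
  B≡true⇒Adj {x} {y} x-vertex@(x-on , _) y-vertex@(y-on , _) x≢y Bxy≡true =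
    x-vertex , y-vertex , x≢y , inj₁ (x , y , here refl , there (here refl) , x≢y , x-on , y-on , on-line)
    where
    on-line : ∀ z → z ∈ linePoints x y → OnQuadric z → z ≡ x ⊎ z ≡ y
    on-line z (here z≡x)                  _        = inj₁ z≡x
    on-line z (there (here z≡y))          _        = inj₂ z≡y
    on-line z (there (there (here refl))) (_ , qz) =
      case trans (sym Bxy≡true) (trans (sym (q-⊕-singular {x} {y} (proj₂ x-on) (proj₂ y-on))) qz) of λ ()

  ≈⇒Adj : ∀ {x y} → IsVertex x → IsVertex y → x ≢ y → x ≈ y → Adj x y
  ≈⇒Adj {x} {y} x-vertex@(x-on , x∉Π) y-vertex@(y-on , y∉Π) x≢y x≈y =
    x-vertex , y-vertex , x≢y ,
    inj₂ ((x-on ∷ y-on ∷ (⊕≢𝟘 x≢y , Π-singular (x ⊕ y) x≈y) ∷ []) ,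
          x ⊕ y , there (there (here refl)) , x≈y , only-x⊕y)
    where
    only-x⊕y : ∀ z → z ∈ linePoints x y → InΠ z → z ≡ x ⊕ y
    only-x⊕y z (here refl)                  z∈Π = ⊥-elim (x∉Π z∈Π)
    only-x⊕y z (there (here refl))          z∈Π = ⊥-elim (y∉Π z∈Π)
    only-x⊕y z (there (there (here z≡x⊕y))) _   = z≡x⊕y

  -- The third point x ⊕ y of the line through two adjacent vertices is never a vertex.
  vertex∉line : ∀ {x y z} → Adj x y → IsVertex z → z ≢ x → z ≢ y → ¬ InSpan (x ∷ y ∷ []) z
  vertex∉line {x} {y} {z} adj z-vertex@((z≢𝟘 , _) , _) z≢x z≢y =
    [ ∉⟨point⟩ z≢𝟘 z≢y , x⊕z∉ ]′ ∘ InSpan-∷⁻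
    where
    x⊕y-not-vertex : ¬ IsVertex (x ⊕ y)
    x⊕y-not-vertex ((_ , q≡false) , x⊕y∉Π) =
      [ (λ Bxy≡true → case trans (sym Bxy≡true)
                              (trans (sym (q-⊕-singular {x} {y} (proj₂ (proj₁ (proj₁ adj)))
                                                                (proj₂ (proj₁ (proj₁ (proj₂ adj))))))
                                     q≡false) of λ ())
      , x⊕y∉Π ]′ (Adj⇒B≡true⊎≈ adj)
    x⊕z∉ : ¬ InSpan (y ∷ []) (x ⊕ z)
    x⊕z∉ = [ (λ x⊕z∈ → z≢x (sym (⊕≡0⇒≡ x z (InSpan-[]⁻ x⊕z∈))))
           , (λ y⊕x⊕z∈ → x⊕y-not-vertex (subst IsVertex (z≡x⊕y y⊕x⊕z∈) z-vertex))
           ]′ ∘ InSpan-∷⁻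
      where
      z≡x⊕y : InSpan [] (y ⊕ (x ⊕ z)) → z ≡ x ⊕ y
      z≡x⊕y e = trans (sym (x⊕[x⊕y]≡y x z)) (cong (x ⊕_) (sym (⊕≡0⇒≡ y (x ⊕ z) (InSpan-[]⁻ e))))

  triangle-independent : ∀ {x y z} → IsClique (x ∷ y ∷ z ∷ []) → LinIndep (x ∷ y ∷ z ∷ [])
  triangle-independent {x} {y} {z}
    (((x≢y ∷ x≢z ∷ []) AllPairs.∷ (y≢z ∷ []) AllPairs.∷ _) ,
     (x-vertex ∷ y-vertex ∷ z-vertex ∷ []) , adjacent) =
    LinIndep-∷ʳ {z} {x ∷ y ∷ []}
      (LinIndep-∷ʳ {y} {x ∷ []} (LinIndep-∷ʳ {x} {[]} LinIndep-[] (proj₁ (proj₁ x-vertex) ∘ InSpan-[]⁻))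
                                (∉⟨point⟩ (proj₁ (proj₁ y-vertex)) (x≢y ∘ sym)))
      (vertex∉line (adjacent x y (here refl) (there (here refl)) x≢y) z-vertex (x≢z ∘ sym) (y≢z ∘ sym))

  ∼₂-Any⇒≈ : ∀ {u xs} → IsVertex u → All IsVertex xs → Any (u ∼₂_) xs → Any (u ≈_) xs
  ∼₂-Any⇒≈ u-vertex (x-vertex ∷ _) (here u∼₂x)     = here (∼₂⇒≈ u-vertex x-vertex u∼₂x)
  ∼₂-Any⇒≈ u-vertex (_ ∷ vertices) (there u∼₂any) = there (∼₂-Any⇒≈ u-vertex vertices u∼₂any)

  MixedType⇒classes : ∀ {x y z} → IsClique (x ∷ y ∷ z ∷ []) → MixedType x y z →
                      Any (λ p → proj₁ p ≈ proj₂ p) (pairs x y z) ×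
                      Any (λ p → ¬ proj₁ p ≈ proj₂ p) (pairs x y z)
  MixedType⇒classes {x} {y} {z}
    (((x≢y ∷ x≢z ∷ []) AllPairs.∷ (y≢z ∷ []) AllPairs.∷ _) , (x-v ∷ y-v ∷ z-v ∷ []) , _)
    (secant , tangent) = related tangent , unrelated secant
    where
    related : Any (λ p → proj₁ p ∼₂ proj₂ p) (pairs x y z) → Any (λ p → proj₁ p ≈ proj₂ p) (pairs x y z)
    related (here r)                 = here (∼₂⇒≈ x-v y-v r)
    related (there (here r))         = there (here (∼₂⇒≈ x-v z-v r))
    related (there (there (here r))) = there (there (here (∼₂⇒≈ y-v z-v r)))
    unrelated : Any (λ p → proj₁ p ∼₁ proj₂ p) (pairs x y z) → Any (λ p → ¬ proj₁ p ≈ proj₂ p) (pairs x y z)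
    unrelated (here r)                 = here (B≡true⇒≉ x-v y-v (∼₁⇒B≡true x-v y-v x≢y r))
    unrelated (there (here r))         = there (here (B≡true⇒≉ x-v z-v (∼₁⇒B≡true x-v z-v x≢z r)))
    unrelated (there (there (here r))) = there (there (here (B≡true⇒≉ y-v z-v (∼₁⇒B≡true y-v z-v y≢z r))))

  independent-mod-Π : ∀ {x y} → ¬ InΠ x → ¬ InΠ y → ¬ x ≈ y → LinIndep (x ∷ y ∷ Π)
  independent-mod-Π {x} {y} x∉Π y∉Π x≉y =
    LinIndep-∷ (LinIndep-∷ Π-indep y∉Π) ([ x∉Π , x≉y ∘ ≈-sym ]′ ∘ InSpan-∷⁻)

  module Quadruple {γ : List V} (γ-clique : IsClique γ) {x₀ x₁ x₂ x₃ : V}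
                   (γ↭xs : γ ↭ x₀ ∷ x₁ ∷ x₂ ∷ x₃ ∷ [])
                   (x₀≉x₁ : ¬ x₀ ≈ x₁) (x₂-class : x₂ ≈ x₀ ⊎ x₂ ≈ x₁) (x₃-class : x₃ ≈ x₀ ⊎ x₃ ≈ x₁)
                   (x₃∉ : ¬ InSpan (x₀ ∷ x₁ ∷ x₂ ∷ []) x₃) where

    xs : List V
    xs = x₀ ∷ x₁ ∷ x₂ ∷ x₃ ∷ []

    private
      xs-clique : IsClique xs
      xs-clique = IsClique-resp-↭ γ↭xs γ-clique

      x₀∈ : x₀ ∈ xs
      x₀∈ = here refl

      x₁∈ : x₁ ∈ xs
      x₁∈ = there (here refl)

      x₂∈ : x₂ ∈ xs
      x₂∈ = there (there (here refl))

      x₃∈ : x₃ ∈ xs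
      x₃∈ = there (there (there (here refl)))

      representative : ∀ {x} → x ≈ x₀ ⊎ x ≈ x₁ → Σ V λ r → r ∈ x₀ ∷ x₁ ∷ [] × x ≈ r
      representative = [ (λ x≈x₀ → x₀ , here refl , x≈x₀) , (λ x≈x₁ → x₁ , there (here refl) , x≈x₁) ]′

      x₀x₁⊆xs : ∀ {r} → r ∈ x₀ ∷ x₁ ∷ [] → r ∈ xs
      x₀x₁⊆xs (here refl)         = here refl
      x₀x₁⊆xs (there (here refl)) = there (here refl)

      c₂ c₃ : V
      c₂ = proj₁ (representative x₂-class)
      c₃ = proj₁ (representative x₃-class)

      c₂∈ : c₂ ∈ x₀ ∷ x₁ ∷ []
      c₂∈ = proj₁ (proj₂ (representative x₂-class))

      c₃∈ : c₃ ∈ x₀ ∷ x₁ ∷ []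
      c₃∈ = proj₁ (proj₂ (representative x₃-class))

    vertex : ∀ {p} → p ∈ xs → IsVertex p
    vertex = All.lookup (proj₁ (proj₂ xs-clique))

    ≉⇒B≡true : ∀ {p p′} → p ∈ xs → p′ ∈ xs → ¬ p ≈ p′ → B p p′ ≡ true
    ≉⇒B≡true {p} {p′} p∈ p′∈ p≉p′ =
      Adj-≉⇒B≡true (proj₂ (proj₂ xs-clique) p p′ p∈ p′∈ (λ { refl → p≉p′ ≈-refl })) p≉p′

    B-resp-≈ : ∀ {p y y′} → p ∈ xs → y ∈ xs → y′ ∈ xs → y ≈ y′ → B p y ≡ B p y′
    B-resp-≈ {p} {y} {y′} p∈ y∈ y′∈ y≈y′ with p ≈? y
    ... | yes p≈y = trans (≈⇒B≡false (vertex p∈) (vertex y∈) p≈y)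
                          (sym (≈⇒B≡false (vertex p∈) (vertex y′∈) (≈-trans p≈y y≈y′)))
    ... | no  p≉y = trans (≉⇒B≡true p∈ y∈ p≉y) (sym (≉⇒B≡true p∈ y′∈ (p≉y ∘ flip ≈-trans (≈-sym y≈y′))))

    B-class-difference : ∀ {p y y′} → p ∈ xs → y ∈ xs → y′ ∈ xs → y ≈ y′ → B p (y ⊕ y′) ≡ false
    B-class-difference {p} {y} {y′} p∈ y∈ y′∈ y≈y′ =
      trans (B-⊕ʳ p y y′) (trans (cong (_xor B p y′) (B-resp-≈ p∈ y∈ y′∈ y≈y′)) (xor-same (B p y′)))

    class : ∀ {p} → p ∈ xs → p ≈ x₀ ⊎ p ≈ x₁
    class (here refl)                         = inj₁ ≈-refl
    class (there (here refl))                 = inj₂ ≈-refl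
    class (there (there (here refl)))         = x₂-class
    class (there (there (there (here refl)))) = x₃-class

    other-class : ∀ {p} → p ∈ xs → Σ V λ p′ → p′ ∈ xs × ¬ p ≈ p′
    other-class p∈ = [ (λ p≈x₀ → x₁ , x₁∈ , λ p≈x₁ → x₀≉x₁ (≈-trans (≈-sym p≈x₀) p≈x₁))
                     , (λ p≈x₁ → x₀ , x₀∈ , λ p≈x₀ → x₀≉x₁ (≈-trans (≈-sym p≈x₀) p≈x₁))
                     ]′ (class p∈)

    -- a and b span the line l = γ ∩ Π, the vertex of the cone.
    a b : V
    a = x₂ ⊕ c₂
    b = x₃ ⊕ c₃

    ℓ : List V
    ℓ = a ∷ b ∷ []

    a∈Π : InΠ a
    a∈Π = proj₂ (proj₂ (representative x₂-class))

    b∈Π : InΠ b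
    b∈Π = proj₂ (proj₂ (representative x₃-class))

    ⟨ℓ⟩⊆Π : ∀ {x} → InSpan ℓ x → InΠ x
    ⟨ℓ⟩⊆Π = InSpan-⊆ {ℓ} {Π} λ { (here refl) → a∈Π ; (there (here refl)) → b∈Π }

    ℓ⊆⟨xs⟩ : ∀ {r} → r ∈ ℓ → InSpan xs r
    ℓ⊆⟨xs⟩ (here refl)         = InSpan-⊕ {xs} (InSpan-∈ x₂∈) (InSpan-∈ (x₀x₁⊆xs c₂∈))
    ℓ⊆⟨xs⟩ (there (here refl)) = InSpan-⊕ {xs} (InSpan-∈ x₃∈) (InSpan-∈ (x₀x₁⊆xs c₃∈))

    ⟨ℓ⟩⊆⟨xs⟩ : ∀ {x} → InSpan ℓ x → InSpan xs x
    ⟨ℓ⟩⊆⟨xs⟩ = InSpan-⊆ {ℓ} {xs} ℓ⊆⟨xs⟩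

    ℓ⊥xs : ∀ {r p} → r ∈ ℓ → p ∈ xs → B r p ≡ false
    ℓ⊥xs {p = p} (here refl) p∈ =
      trans (B-sym a p) (B-class-difference p∈ x₂∈ (x₀x₁⊆xs c₂∈) a∈Π)
    ℓ⊥xs {p = p} (there (here refl)) p∈ =
      trans (B-sym b p) (B-class-difference p∈ x₃∈ (x₀x₁⊆xs c₃∈) b∈Π)

    ⟨xs⟩⊥⟨ℓ⟩ : ∀ {y z} → InSpan xs y → InSpan ℓ z → B y z ≡ false
    ⟨xs⟩⊥⟨ℓ⟩ {y} {z} y∈ = ⊥-span {y} {ℓ} λ {r} r∈ → trans (B-sym y r) (⊥-span {r} {xs} (ℓ⊥xs r∈) y∈)

    ℓ-indep : LinIndep ℓ
    ℓ-indep = LinIndep-∷ʳ {b} {a ∷ []} (LinIndep-∷ʳ {a} {[]} LinIndep-[] a∉) b∉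
      where
      x₂∉x₀x₁ : x₂ ∉ x₀ ∷ x₁ ∷ []
      x₂∉x₀x₁ with proj₁ xs-clique
      ... | (_ ∷ x₀≢x₂ ∷ _) AllPairs.∷ (x₁≢x₂ ∷ _) AllPairs.∷ _ =
        λ { (here x₂≡x₀) → x₀≢x₂ (sym x₂≡x₀) ; (there (here x₂≡x₁)) → x₁≢x₂ (sym x₂≡x₁) }
      a∉ : ¬ InSpan [] a
      a∉ a∈ = x₂∉x₀x₁ (subst (_∈ _) (sym (⊕≡0⇒≡ x₂ c₂ (InSpan-[]⁻ a∈))) c₂∈)
      x₀x₁x₂ : List V
      x₀x₁x₂ = x₀ ∷ x₁ ∷ x₂ ∷ []
      x₀x₁⊆x₀x₁x₂ : ∀ {r} → r ∈ x₀ ∷ x₁ ∷ [] → r ∈ x₀x₁x₂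
      x₀x₁⊆x₀x₁x₂ (here refl)         = here refl
      x₀x₁⊆x₀x₁x₂ (there (here refl)) = there (here refl)
      b∉ : ¬ InSpan (a ∷ []) b
      b∉ b∈ = x₃∉ (subst (InSpan x₀x₁x₂) (x⊕[y⊕x]≡y c₃ x₃)
                         (InSpan-⊕ {x₀x₁x₂} (InSpan-∈ (x₀x₁⊆x₀x₁x₂ c₃∈)) b∈⟨x₀x₁x₂⟩))
        where
        a∈⟨x₀x₁x₂⟩ : InSpan x₀x₁x₂ a
        a∈⟨x₀x₁x₂⟩ = InSpan-⊕ {x₀x₁x₂} (InSpan-∈ (there (there (here refl)))) (InSpan-∈ (x₀x₁⊆x₀x₁x₂ c₂∈))
        b∈⟨x₀x₁x₂⟩ : InSpan x₀x₁x₂ b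
        b∈⟨x₀x₁x₂⟩ = InSpan-⊆ {a ∷ []} {x₀x₁x₂} (λ { (here refl) → a∈⟨x₀x₁x₂⟩ }) b∈

    frame-indep : LinIndep (a ∷ b ∷ x₀ ∷ x₁ ∷ [])
    frame-indep =
      LinIndep-∷ʳ {x₁} {a ∷ b ∷ x₀ ∷ []} (LinIndep-∷ʳ {x₀} {ℓ} ℓ-indep (proj₂ (vertex x₀∈) ∘ ⟨ℓ⟩⊆Π)) x₁∉
      where
      x₀⊥ : ∀ {r} → r ∈ a ∷ b ∷ x₀ ∷ [] → B x₀ r ≡ false
      x₀⊥ (here refl)                 = trans (B-sym x₀ a) (ℓ⊥xs (here refl) x₀∈)
      x₀⊥ (there (here refl))         = trans (B-sym x₀ b) (ℓ⊥xs (there (here refl)) x₀∈)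
      x₀⊥ (there (there (here refl))) = B-self x₀
      x₁∉ : ¬ InSpan (a ∷ b ∷ x₀ ∷ []) x₁
      x₁∉ x₁∈⟨abx₀⟩ =
        case trans (sym (≉⇒B≡true x₀∈ x₁∈ x₀≉x₁)) (⊥-span {x₀} {a ∷ b ∷ x₀ ∷ []} {x₁} x₀⊥ x₁∈⟨abx₀⟩) of λ ()

    private
      x₀x₁ℓ : List V
      x₀x₁ℓ = x₀ ∷ x₁ ∷ ℓ

      x₀x₁⊆x₀x₁ℓ : ∀ {r} → r ∈ x₀ ∷ x₁ ∷ [] → r ∈ x₀x₁ℓ
      x₀x₁⊆x₀x₁ℓ (here refl)         = here refl
      x₀x₁⊆x₀x₁ℓ (there (here refl)) = there (here refl)

      ⟨xs⟩⊆⟨x₀x₁ℓ⟩ : ∀ {y} → InSpan xs y → InSpan x₀x₁ℓ y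
      ⟨xs⟩⊆⟨x₀x₁ℓ⟩ = InSpan-⊆ {xs} {x₀x₁ℓ} λ
        { (here refl)                         → InSpan-∈ (here refl)
        ; (there (here refl))                 → InSpan-∈ (there (here refl))
        ; (there (there (here refl)))         →
            subst (InSpan x₀x₁ℓ) (x⊕[y⊕x]≡y c₂ x₂)
                  (InSpan-⊕ {x₀x₁ℓ} (InSpan-∈ (x₀x₁⊆x₀x₁ℓ c₂∈)) (InSpan-∈ (there (there (here refl)))))
        ; (there (there (there (here refl)))) →
            subst (InSpan x₀x₁ℓ) (x⊕[y⊕x]≡y c₃ x₃)
                  (InSpan-⊕ {x₀x₁ℓ} (InSpan-∈ (x₀x₁⊆x₀x₁ℓ c₃∈))
                                    (InSpan-∈ (there (there (there (here refl))))))
        }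

    solid-cosets : ∀ {x} → InSpan xs x →
                   InSpan ℓ x ⊎ InSpan ℓ (x₀ ⊕ x) ⊎ InSpan ℓ (x₁ ⊕ x) ⊎ InSpan ℓ ((x₀ ⊕ x₁) ⊕ x)
    solid-cosets {x} x∈ with InSpan-∷⁻ (⟨xs⟩⊆⟨x₀x₁ℓ⟩ x∈)
    ... | inj₁ x∈⟨x₁ℓ⟩    = Sum.map₂ (inj₂ ∘ inj₁) (InSpan-∷⁻ x∈⟨x₁ℓ⟩)
    ... | inj₂ x₀⊕x∈⟨x₁ℓ⟩ =
      [ inj₂ ∘ inj₁ , inj₂ ∘ inj₂ ∘ inj₂ ∘ subst (InSpan ℓ) reassociate ]′ (InSpan-∷⁻ x₀⊕x∈⟨x₁ℓ⟩)
      where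
      reassociate : x₁ ⊕ (x₀ ⊕ x) ≡ (x₀ ⊕ x₁) ⊕ x
      reassociate = trans (sym (⊕-assoc x₁ x₀ x)) (cong (_⊕ x) (⊕-comm x₁ x₀))

    q-coset : ∀ {y x} → InSpan xs y → InSpan ℓ (y ⊕ x) → q x ≡ q y
    q-coset {y} {x} y∈ y⊕x∈ =
      trans (cong q (sym (x⊕[x⊕y]≡y y x)))
            (q-⊕-radical {y} {y ⊕ x} (Π-singular (y ⊕ x) (⟨ℓ⟩⊆Π y⊕x∈)) (⟨xs⟩⊥⟨ℓ⟩ y∈ y⊕x∈))

    ∈Π-coset : ∀ {y x} → InSpan ℓ (y ⊕ x) → InΠ x → InΠ y
    ∈Π-coset {y} {x} y⊕x∈ x∈Π =
      subst InΠ (trans (⊕-assoc y x x) (trans (cong (y ⊕_) (⊕-self x)) (⊕-identityʳ y)))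
            (InSpan-⊕ {Π} (⟨ℓ⟩⊆Π y⊕x∈) x∈Π)

    off-quadric : ∀ {x} → q x ≡ false → ¬ InSpan ℓ ((x₀ ⊕ x₁) ⊕ x)
    off-quadric {x} qx x∈coset =
      case trans (sym qx) (trans (q-coset x₀⊕x₁∈ x∈coset) q-x₀⊕x₁) of λ ()
      where
      x₀⊕x₁∈ : InSpan xs (x₀ ⊕ x₁)
      x₀⊕x₁∈ = InSpan-⊕ {xs} (InSpan-∈ x₀∈) (InSpan-∈ x₁∈)
      q-x₀⊕x₁ : q (x₀ ⊕ x₁) ≡ true
      q-x₀⊕x₁ = trans (q-⊕-singular {x₀} {x₁} (proj₂ (proj₁ (vertex x₀∈))) (proj₂ (proj₁ (vertex x₁∈))))
                      (≉⇒B≡true x₀∈ x₁∈ x₀≉x₁)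

    coset-vertex : ∀ {y x} → y ∈ xs → InSpan ℓ (y ⊕ x) → IsVertex x
    coset-vertex {y} {x} y∈ y⊕x∈ =
      ((λ x≡𝟘 → y∉Π (∈Π-coset y⊕x∈ (subst InΠ (sym x≡𝟘) (InSpan-𝟘 Π)))) ,
       trans (q-coset (InSpan-∈ y∈) y⊕x∈) (proj₂ (proj₁ (vertex y∈)))) ,
      y∉Π ∘ ∈Π-coset y⊕x∈
      where
      y∉Π : ¬ InΠ y
      y∉Π = proj₂ (vertex y∈)

    coset⊆⟨xs⟩ : ∀ {y x} → y ∈ xs → InSpan ℓ (y ⊕ x) → InSpan xs x
    coset⊆⟨xs⟩ {y} {x} y∈ y⊕x∈ =
      subst (InSpan xs) (x⊕[x⊕y]≡y y x) (InSpan-⊕ {xs} (InSpan-∈ y∈) (⟨ℓ⟩⊆⟨xs⟩ y⊕x∈))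

    solid-vertex-coset : ∀ {x} → IsVertex x → InSpan xs x → InSpan ℓ (x₀ ⊕ x) ⊎ InSpan ℓ (x₁ ⊕ x)
    solid-vertex-coset {x} ((_ , qx) , x∉Π) x∈ =
      [ ⊥-elim ∘ x∉Π ∘ ⟨ℓ⟩⊆Π , [ inj₁ , [ inj₂ , ⊥-elim ∘ off-quadric qx ]′ ]′ ]′ (solid-cosets x∈)

    toγ : ∀ {x} → InSpan xs x → InSpan γ x
    toγ = InSpan-↭ (↭-sym γ↭xs)

    plane⇔ : ∀ {y x} → InSpan (a ∷ b ∷ y ∷ []) x ⇔ (InSpan ℓ x ⊎ InSpan ℓ (y ⊕ x))
    plane⇔ {y} = mk⇔ (InSpan-∷⁻ ∘ InSpan-↭ (shift y ℓ []))
                     (InSpan-↭ (↭-sym (shift y ℓ [])) ∘ [ InSpan-∷⁺ˡ , InSpan-∷⁺ʳ ]′)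

    frame-in-γ : All (InSpan γ) (a ∷ b ∷ x₀ ∷ x₁ ∷ [])
    frame-in-γ = toγ (ℓ⊆⟨xs⟩ (here refl)) ∷ toγ (ℓ⊆⟨xs⟩ (there (here refl))) ∷
                 toγ (InSpan-∈ x₀∈) ∷ toγ (InSpan-∈ x₁∈) ∷ []

    cone : ∀ x → (OnQuadric x × InSpan γ x) ⇔
                 (IsPoint x × (InSpan (a ∷ b ∷ x₀ ∷ []) x ⊎ InSpan (a ∷ b ∷ x₁ ∷ []) x))
    cone x = mk⇔ to from
      where
      in-plane : ∀ {y} → InSpan ℓ x ⊎ InSpan ℓ (y ⊕ x) → InSpan (a ∷ b ∷ y ∷ []) x
      in-plane = Equivalence.from plane⇔
      to : OnQuadric x × InSpan γ x → IsPoint x × (InSpan (a ∷ b ∷ x₀ ∷ []) x ⊎ InSpan (a ∷ b ∷ x₁ ∷ []) x)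
      to ((x-point , qx) , x∈γ) =
        x-point , [ inj₁ ∘ in-plane ∘ inj₁
                  , [ inj₁ ∘ in-plane ∘ inj₂ , [ inj₂ ∘ in-plane ∘ inj₂ , ⊥-elim ∘ off-quadric qx ]′ ]′
                  ]′ (solid-cosets (InSpan-↭ γ↭xs x∈γ))
      singular : ∀ {y} → y ∈ xs → InSpan (a ∷ b ∷ y ∷ []) x → q x ≡ false × InSpan γ x
      singular y∈ =
        [ (λ x∈⟨ℓ⟩ → Π-singular x (⟨ℓ⟩⊆Π x∈⟨ℓ⟩) , toγ (⟨ℓ⟩⊆⟨xs⟩ x∈⟨ℓ⟩))
        , (λ y⊕x∈ → trans (q-coset (InSpan-∈ y∈) y⊕x∈) (proj₂ (proj₁ (vertex y∈))) , toγ (coset⊆⟨xs⟩ y∈ y⊕x∈))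
        ]′ ∘ Equivalence.to plane⇔
      from : IsPoint x × (InSpan (a ∷ b ∷ x₀ ∷ []) x ⊎ InSpan (a ∷ b ∷ x₁ ∷ []) x) → OnQuadric x × InSpan γ x
      from (x-point , x∈planes) =
        let qx , x∈γ = [ singular x₀∈ , singular x₁∈ ]′ x∈planes in (x-point , qx) , x∈γ

    K : List V
    K = List.map (x₀ ⊕_) (spanList ℓ) ++ List.map (x₁ ⊕_) (spanList ℓ)

    ∈K⇔ : ∀ {x} → x ∈ K ⇔ (InSpan ℓ (x₀ ⊕ x) ⊎ InSpan ℓ (x₁ ⊕ x))
    ∈K⇔ {x} = mk⇔ (Sum.map coset coset ∘ ∈-++⁻ (List.map (x₀ ⊕_) (spanList ℓ)))
                  [ ∈-++⁺ˡ ∘ coset⁻ x₀ , ∈-++⁺ʳ (List.map (x₀ ⊕_) (spanList ℓ)) ∘ coset⁻ x₁ ]′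
      where
      coset : ∀ {y} → x ∈ List.map (y ⊕_) (spanList ℓ) → InSpan ℓ (y ⊕ x)
      coset = Equivalence.to (∈spanList⇔InSpan ℓ) ∘ ∈-map-⊕
      coset⁻ : ∀ y → InSpan ℓ (y ⊕ x) → x ∈ List.map (y ⊕_) (spanList ℓ)
      coset⁻ y = subst (_∈ _) (x⊕[x⊕y]≡y y x) ∘ ∈-map⁺ (y ⊕_) ∘ Equivalence.from (∈spanList⇔InSpan ℓ)

    K-vertices : ∀ x → x ∈ K ⇔ (IsVertex x × InSpan γ x)
    K-vertices x = mk⇔
      ([ (λ x∈coset → coset-vertex x₀∈ x∈coset , toγ (coset⊆⟨xs⟩ x₀∈ x∈coset))
       , (λ x∈coset → coset-vertex x₁∈ x∈coset , toγ (coset⊆⟨xs⟩ x₁∈ x∈coset)) ]′ ∘ Equivalence.to ∈K⇔)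
      (λ { (x-vertex , x∈γ) → Equivalence.from ∈K⇔ (solid-vertex-coset x-vertex (InSpan-↭ γ↭xs x∈γ)) })

    same-coset⇒Adj : ∀ {y x z} → y ∈ xs → InSpan ℓ (y ⊕ x) → InSpan ℓ (y ⊕ z) → x ≢ z → Adj x z
    same-coset⇒Adj y∈ y⊕x∈ y⊕z∈ x≢z =
      ≈⇒Adj (coset-vertex y∈ y⊕x∈) (coset-vertex y∈ y⊕z∈) x≢z (≈-trans (≈-sym (⟨ℓ⟩⊆Π y⊕x∈)) (⟨ℓ⟩⊆Π y⊕z∈))

    other-coset⇒Adj : ∀ {y y′ x z} → y ∈ xs → y′ ∈ xs → ¬ y ≈ y′ →
                      InSpan ℓ (y ⊕ x) → InSpan ℓ (y′ ⊕ z) → x ≢ z → Adj x z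
    other-coset⇒Adj {y} {y′} {x} {z} y∈ y′∈ y≉y′ y⊕x∈ y′⊕z∈ x≢z =
      B≡true⇒Adj x-vertex z-vertex x≢z (begin
        B x z         ≡⟨ q-⊕-singular {x} {z} (proj₂ (proj₁ x-vertex)) (proj₂ (proj₁ z-vertex)) ⟨
        q (x ⊕ z)     ≡⟨ q-coset (InSpan-⊕ {xs} (InSpan-∈ y∈) (InSpan-∈ y′∈))
                                 (subst (InSpan ℓ) (⊕-interchange y x y′ z) (InSpan-⊕ {ℓ} y⊕x∈ y′⊕z∈)) ⟩
        q (y ⊕ y′)    ≡⟨ q-⊕-singular {y} {y′} (proj₂ (proj₁ (vertex y∈))) (proj₂ (proj₁ (vertex y′∈))) ⟩
        B y y′        ≡⟨ ≉⇒B≡true y∈ y′∈ y≉y′ ⟩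
        true          ∎)
      where
      open ≡-Reasoning
      x-vertex : IsVertex x
      x-vertex = coset-vertex y∈ y⊕x∈
      z-vertex : IsVertex z
      z-vertex = coset-vertex y′∈ y′⊕z∈

    K-unique : Unique K
    K-unique = Unique.++⁺ (Unique.map⁺ (⊕-injective x₀) ℓ-unique) (Unique.map⁺ (⊕-injective x₁) ℓ-unique)
                          (λ { (x∈₀ , x∈₁) → x₀≉x₁ (≈-trans (class-of x∈₀) (≈-sym (class-of x∈₁))) })
      where
      ℓ-unique : Unique (spanList ℓ)
      ℓ-unique = spanList-unique {ℓ} ℓ-indep
      class-of : ∀ {y x} → x ∈ List.map (y ⊕_) (spanList ℓ) → y ≈ x
      class-of = ⟨ℓ⟩⊆Π ∘ Equivalence.to (∈spanList⇔InSpan ℓ) ∘ ∈-map-⊕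

    K-clique : IsClique K
    K-clique = K-unique , All.tabulate (proj₁ ∘ Equivalence.to (K-vertices _)) , adjacent
      where
      adjacent-cosets : ∀ {x z} → InSpan ℓ (x₀ ⊕ x) ⊎ InSpan ℓ (x₁ ⊕ x) →
                        InSpan ℓ (x₀ ⊕ z) ⊎ InSpan ℓ (x₁ ⊕ z) → x ≢ z → Adj x z
      adjacent-cosets (inj₁ x∈coset) (inj₁ z∈coset) = same-coset⇒Adj x₀∈ x∈coset z∈coset
      adjacent-cosets (inj₁ x∈coset) (inj₂ z∈coset) = other-coset⇒Adj x₀∈ x₁∈ x₀≉x₁ x∈coset z∈coset
      adjacent-cosets (inj₂ x∈coset) (inj₁ z∈coset) = other-coset⇒Adj x₁∈ x₀∈ (x₀≉x₁ ∘ ≈-sym) x∈coset z∈coset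
      adjacent-cosets (inj₂ x∈coset) (inj₂ z∈coset) = same-coset⇒Adj x₁∈ x∈coset z∈coset
      adjacent : ∀ x z → x ∈ K → z ∈ K → x ≢ z → Adj x z
      adjacent x z x∈ z∈ = adjacent-cosets (Equivalence.to ∈K⇔ x∈) (Equivalence.to ∈K⇔ z∈)

    γ⊆K : All (_∈ K) γ
    γ⊆K = All.tabulate λ p∈ →
      Equivalence.from (K-vertices _) (All.lookup (proj₁ (proj₂ γ-clique)) p∈ , InSpan-∈ p∈)

    q-x₁⊕[x₀⊕v]≡true : ∀ {v} → q v ≡ false → B v x₀ ≡ true → B v x₁ ≡ true → q (x₁ ⊕ (x₀ ⊕ v)) ≡ true
    q-x₁⊕[x₀⊕v]≡true {v} qv Bvx₀ Bvx₁ = begin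
      q (x₁ ⊕ (x₀ ⊕ v))                       ≡⟨ q-⊕ x₁ (x₀ ⊕ v) ⟩
      (q x₁ xor q (x₀ ⊕ v)) xor B x₁ (x₀ ⊕ v)
        ≡⟨ cong₂ (λ s t → (s xor t) xor B x₁ (x₀ ⊕ v)) q₁ (q-⊕-singular {x₀} {v} q₀ qv) ⟩
      B x₀ v xor B x₁ (x₀ ⊕ v)
        ≡⟨ cong₂ _xor_ (trans (B-sym x₀ v) Bvx₀) (B-⊕ʳ x₁ x₀ v) ⟩
      true xor (B x₁ x₀ xor B x₁ v)
        ≡⟨ cong (λ t → true xor (t xor B x₁ v)) (≉⇒B≡true x₁∈ x₀∈ (x₀≉x₁ ∘ ≈-sym)) ⟩
      true xor (true xor B x₁ v)
        ≡⟨ cong (λ t → true xor (true xor t)) (trans (B-sym x₁ v) Bvx₁) ⟩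
      true                                    ∎
      where
      open ≡-Reasoning
      q₀ : q x₀ ≡ false
      q₀ = proj₂ (proj₁ (vertex x₀∈))
      q₁ : q x₁ ≡ false
      q₁ = proj₂ (proj₁ (vertex x₁∈))

    -- Otherwise v would be orthogonal to l, hence in ⟨x₀, x₁⟩ + Π, and the points of
    -- x₀ + x₁ + Π are off the quadric.
    common-neighbour-class : ∀ {v} → IsVertex v → AdjacentToAll xs v → Any (v ≈_) xs
    common-neighbour-class {v} ((_ , qv) , v∉Π) adjacent with Any.any? (v ≈?_) xs
    ... | yes v≈some = v≈some
    ... | no  v≉all  = ⊥-elim ([ [ v∉Π , v≉ x₁∈ ∘ ≈-sym ]′ ∘ InSpan-∷⁻
                              , [ v≉ x₀∈ ∘ ≈-sym , x₁⊕x₀⊕v∉Π ]′ ∘ InSpan-∷⁻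
                              ]′ (InSpan-∷⁻ v∈⟨x₀x₁Π⟩))
      where
      v≉ : ∀ {p} → p ∈ xs → ¬ v ≈ p
      v≉ p∈ v≈p = v≉all (lose p∈ v≈p)
      B-v : ∀ {p} → p ∈ xs → B v p ≡ true
      B-v {p} p∈ = Adj-≉⇒B≡true (adjacent p p∈ (λ { refl → v≉ p∈ ≈-refl })) (v≉ p∈)
      v⊥ℓ : ∀ {r} → r ∈ ℓ → B v r ≡ false
      v⊥ℓ (here refl) =
        trans (B-⊕ʳ v x₂ c₂) (cong₂ _xor_ (B-v x₂∈) (B-v (x₀x₁⊆xs c₂∈)))
      v⊥ℓ (there (here refl)) =
        trans (B-⊕ʳ v x₃ c₃) (cong₂ _xor_ (B-v x₃∈) (B-v (x₀x₁⊆xs c₃∈)))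
      x₀x₁Π⊥ℓ : Orthogonal (x₀ ∷ x₁ ∷ Π) ℓ
      x₀x₁Π⊥ℓ (here refl)          r∈ = trans (B-sym x₀ _) (ℓ⊥xs r∈ x₀∈)
      x₀x₁Π⊥ℓ (there (here refl))  r∈ = trans (B-sym x₁ _) (ℓ⊥xs r∈ x₁∈)
      x₀x₁Π⊥ℓ (there (there π∈Π)) r∈ = Π-isotropic (InSpan-∈ π∈Π) (⟨ℓ⟩⊆Π (InSpan-∈ r∈))
      v∈⟨x₀x₁Π⟩ : InSpan (x₀ ∷ x₁ ∷ Π) v
      v∈⟨x₀x₁Π⟩ = ⊥-complement-spanned {x₀ ∷ x₁ ∷ Π} {ℓ}
        (independent-mod-Π (proj₂ (vertex x₀∈)) (proj₂ (vertex x₁∈)) x₀≉x₁) ℓ-indep x₀x₁Π⊥ℓ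
        (cong (λ n → 2 + n + 2) |Π|≡4) v⊥ℓ
      x₁⊕x₀⊕v∉Π : ¬ InΠ (x₁ ⊕ (x₀ ⊕ v))
      x₁⊕x₀⊕v∉Π x₁⊕x₀⊕v∈Π =
        case trans (sym (Π-singular _ x₁⊕x₀⊕v∈Π)) (q-x₁⊕[x₀⊕v]≡true qv (B-v x₀∈) (B-v x₁∈)) of λ ()

    -- With p′ in the other class, v ⊕ p ∈ Π ∩ ⟨p, p′⟩^⊥, which is l by counting dimensions.
    common-neighbour-in-solid : ∀ {v} → IsVertex v → AdjacentToAll xs v → InSpan xs v
    common-neighbour-in-solid {v} v-vertex adjacent with find (common-neighbour-class v-vertex adjacent)
    ... | p , p∈ , v≈p with other-class p∈
    ...   | p′ , p′∈ , p≉p′ =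
      subst (InSpan xs) (x⊕[y⊕x]≡y p v) (InSpan-⊕ {xs} (InSpan-∈ p∈) (⟨ℓ⟩⊆⟨xs⟩ v⊕p∈⟨ℓ⟩))
      where
      v≉p′ : ¬ v ≈ p′
      v≉p′ v≈p′ = p≉p′ (≈-trans (≈-sym v≈p) v≈p′)
      ℓ⊥pp′Π : Orthogonal ℓ (p ∷ p′ ∷ Π)
      ℓ⊥pp′Π r∈ (here refl)          = ℓ⊥xs r∈ p∈
      ℓ⊥pp′Π r∈ (there (here refl))  = ℓ⊥xs r∈ p′∈
      ℓ⊥pp′Π r∈ (there (there π∈Π)) = Π-isotropic (⟨ℓ⟩⊆Π (InSpan-∈ r∈)) (InSpan-∈ π∈Π)
      v⊕p⊥ : ∀ {y} → y ∈ p ∷ p′ ∷ Π → B (v ⊕ p) y ≡ false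
      v⊕p⊥ (here refl) =
        trans (B-⊕ˡ v p p) (cong₂ _xor_ (≈⇒B≡false v-vertex (vertex p∈) v≈p) (B-self p))
      v⊕p⊥ (there (here refl)) =
        trans (B-⊕ˡ v p p′) (cong₂ _xor_ (Adj-≉⇒B≡true (adjacent p′ p′∈ (λ { refl → v≉p′ ≈-refl })) v≉p′)
                                         (≉⇒B≡true p∈ p′∈ p≉p′))
      v⊕p⊥ (there (there π∈Π)) = Π-isotropic v≈p (InSpan-∈ π∈Π)
      v⊕p∈⟨ℓ⟩ : InSpan ℓ (v ⊕ p)
      v⊕p∈⟨ℓ⟩ = ⊥-complement-spanned {ℓ} {p ∷ p′ ∷ Π}
        ℓ-indep (independent-mod-Π (proj₂ (vertex p∈)) (proj₂ (vertex p′∈)) p≉p′) ℓ⊥pp′Π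
        (cong (4 +_) |Π|≡4) v⊕p⊥

    common-neighbour∈K : ∀ v → IsVertex v → AdjacentToAll γ v → v ∈ K
    common-neighbour∈K v v-vertex adjacent =
      Equivalence.from (K-vertices v)
        (v-vertex , toγ (common-neighbour-in-solid v-vertex (λ s → adjacent s ∘ ∈-resp-↭ (↭-sym γ↭xs))))

lemma4p12 : (c : Coeffs) → NonDegenerate c →
    (Π : List V) → length Π ≡ 4 → LinIndep Π →
    ((x : V) → InSpan Π x → evalQ c x ≡ false) →
    let open Geometry c Π in
    (P Q R T : V) →
    IsClique (P ∷ Q ∷ R ∷ []) → MixedType P Q R →
    ¬ InSpan (P ∷ Q ∷ R ∷ []) T →
    IsClique (P ∷ Q ∷ R ∷ T ∷ []) →
    Any (λ X → T ∼₂ X) (P ∷ Q ∷ R ∷ []) →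
    LinIndep (P ∷ Q ∷ R ∷ T ∷ []) ×
    Σ V (λ a → Σ V (λ b → LinIndep (a ∷ b ∷ []) × InΠ a × InΠ b ×
      IsConeOverPointPair (P ∷ Q ∷ R ∷ T ∷ []) a b)) ×
    Σ (List V) (λ K → IsMaximalClique K × All (_∈ K) (P ∷ Q ∷ R ∷ T ∷ []) ×
      length K ≡ 8 ×
      ((x : V) → x ∈ K ⇔ (IsVertex x × InSpan (P ∷ Q ∷ R ∷ T ∷ []) x)) ×
      ((K′ : List V) → IsMaximalClique K′ → All (_∈ K′) (P ∷ Q ∷ R ∷ T ∷ []) →
        (x : V) → x ∈ K′ ⇔ x ∈ K))
lemma4p12 c nd Π |Π|≡4 Π-indep Π-singular P Q R T PQR-clique mixed T∉⟨PQR⟩ γ-clique T∼₂ =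
  LinIndep-∷ʳ {T} {P ∷ Q ∷ R ∷ []} (triangle-independent PQR-clique) T∉⟨PQR⟩ ,
  (a , b , ℓ-indep , a∈Π , b∈Π , P , w , frame-indep , frame-in-γ , cone) ,
  (K , proj₁ K-unique-maximal , γ⊆K , refl , K-vertices , proj₂ K-unique-maximal)
  where
  open Geometry c Π
  open Generator c nd Π |Π|≡4 Π-indep Π-singular
  open Cliques c Π
  split-PQR : Split P Q R
  split-PQR = uncurry (split P Q R) (MixedType⇒classes PQR-clique mixed)
  open Split split-PQR
  T-class : T ≈ P ⊎ T ≈ w
  T-class = related-class split-PQR
    (∼₂-Any⇒≈ (All.lookup (proj₁ (proj₂ γ-clique)) (there (there (there (here refl)))))
              (proj₁ (proj₂ PQR-clique)) T∼₂)
  open Quadruple γ-clique (prep P (++⁺ʳ [ T ] y∷z↭w∷t)) x≉w t-class T-class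
                 (T∉⟨PQR⟩ ∘ InSpan-↭ (↭-sym (prep P y∷z↭w∷t)))
  K-unique-maximal : IsMaximalClique K ×
                     (∀ K′ → IsMaximalClique K′ → All (_∈ K′) (P ∷ Q ∷ R ∷ T ∷ []) → ∀ x → x ∈ K′ ⇔ x ∈ K)
  K-unique-maximal = unique-maximal-clique K-clique γ⊆K common-neighbour∈K
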